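{- Let $G=(V,E)$ be a connected graph with $n$ vertices, let $\tau$ be a set of types, let $f:\tau\to\mathbb{Q}_{\ge1}$ be a fitness function, let $\alpha\in\tau_{\max}(f)$, and let $D\in\mathcal D(G,\tau)$. Then $\pi_\alpha(G,\tau,f,D)\ge1/n$.
   Context: $\tau_{\max}(f)=\{i\in\tau: f(i)=\max_{j\in\tau}f(j)\}$. $\Omega$ is the set of functions $V\to\tau$. For $S\in\Omega$, $S|_{v\to w}$ equals $S$ except that $w$ gets type $S(v)$. The Moran process $M(G,\tau,f,M_0)$ is the Markov chain on $\Omega$ started at $M_0$ in which, given $M_t$, a vertex $v$ is chosen with probability $f(M_t(v))/\sum_u f(M_t(u))$, then a uniformly random neighbour $w$ of $v$, and $M_{t+1}=M_t|_{v\to w}$. $\pi_j(G,\tau,f,M_0)$ is the probability that type $j$ fixates (eventually all vertices have type $j$), and for a distribution $D$ on $\Omega$, $\pi_j(G,\tau,f,D)=\sum_S\Pr_D(S)\pi_j(G,\tau,f,S)$. With $k=|\tau|$, $V[k]$ is the set of $k$-tuples of distinct vertices, $\tau[k]$ the set of $k$-tuples of distinct types, and $\Omega(\mathbf u,\boldsymbol\gamma)$ the set of states mapping the $i$-th entry of $\mathbf u$ to the $i$-th entry of $\boldsymbol\gamma$ for all $i$. $\mathcal D(G,\tau)$ is the set of distributions $D$ on $\Omega$ such that there are distributions $D_{\mathbf u,\boldsymbol\gamma}$ on $\Omega(\mathbf u,\boldsymbol\gamma)$ with $\Pr_D(S)=\frac{1}{|V[k]\times\tau[k]|}\sum_{(\mathbf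 u,\boldsymbol\gamma)\in V[k]\times\tau[k]}\Pr_{D_{\mathbf u,\boldsymbol\gamma}}(S)$ for all $S$.
   Formalization: The distribution D and the distributions $D_{\mathbf u,\boldsymbol\gamma}$ assign only rational probabilities to the states in Ω. -}

module Defs where

open import Data.Bool using (Bool; true; false; if_then_else_; _∧_; not)
open import Data.Nat using (ℕ; zero; suc)
open import Data.Fin using (Fin; _≟_)
open import Data.Vec using (Vec; []; _∷_; lookup; _[_]≔_; toList)
open import Data.List using (List; []; _∷_; map; concatMap; allFin; foldr; length; filterᵇ; cartesianProduct)
open import Data.Product using (_×_; _,_; Σ; ∃)
open import Data.Rational using (ℚ; 0ℚ; 1ℚ; _+_; _*_; _÷_; _≤_; _<_; ≢-nonZero)
import Data.Rational.Properties as ℚP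
open import Relation.Nullary using (yes; no; does)
open import Relation.Binary.PropositionalEquality using (_≡_)

record Graph (n : ℕ) : Set where
  field
    adj     : Fin n → Fin n → Bool
    adj-sym : ∀ u v → adj u v ≡ adj v u
    irrefl  : ∀ v → adj v v ≡ false
open Graph public

data Walk {n : ℕ} (G : Graph n) : Fin n → Fin n → Set where
  here  : ∀ {u} → Walk G u u
  there : ∀ {u v w} → adj G u v ≡ true → Walk G v w → Walk G u w

Connected : ∀ {n} → Graph n → Set
Connected {n} G = ∀ (u v : Fin n) → Walk G u v

ΣL : ∀ {A : Set} → List A → (A → ℚ) → ℚ
ΣL xs g = foldr (λ x acc → g x + acc) 0ℚ xs

sumℕ : List ℕ → ℕ
sumℕ = foldr Data.Nat._+_ 0

-- total division: q / 0 := 0 (only used where the denominator is positive)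
divQ : ℚ → ℚ → ℚ
divQ p q with q Data.Rational.≟ 0ℚ
... | yes _  = 0ℚ
... | no q≢0 = _÷_ p q {{≢-nonZero q≢0}}

ℕtoℚ : ℕ → ℚ
ℕtoℚ m = Data.Rational._/_ (Data.Integer.+_ m) 1
  where import Data.Integer

-- States: Ω = functions V → τ, with V = Fin n, τ = Fin k, as vectors

State : ℕ → ℕ → Set
State n k = Vec (Fin k) n

allStates : (n k : ℕ) → List (State n k)
allStates zero    k = [] ∷ []
allStates (suc n) k = concatMap (λ x → map (x ∷_) (allStates n k)) (allFin k)

allTuples : (m r : ℕ) → List (Vec (Fin r) m)
allTuples m r = allStates m r

_∣_⇒_ : ∀ {n k} → State n k → Fin n → Fin n → State n k
S ∣ v ⇒ w = S [ w ]≔ lookup S v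

notIn : ∀ {r} → Fin r → List (Fin r) → Bool
notIn x []       = true
notIn x (y ∷ ys) = not (does (x ≟ y)) ∧ notIn x ys

distinctL : ∀ {r} → List (Fin r) → Bool
distinctL []       = true
distinctL (x ∷ xs) = notIn x xs ∧ distinctL xs

distinct : ∀ {r m} → Vec (Fin r) m → Bool
distinct v = distinctL (toList v)

tuplePairs : (n k : ℕ) → List (Vec (Fin n) k × Vec (Fin k) k)
tuplePairs n k = cartesianProduct (filterᵇ distinct (allTuples k n))
                                  (filterᵇ distinct (allTuples k k))

InΩ : ∀ {n k} → Vec (Fin n) k → Vec (Fin k) k → State n k → Set
InΩ {k = k} u γ S = ∀ (i : Fin k) → lookup S (lookup u i) ≡ lookup γ i

IsDist : ∀ {n k} → (State n k → ℚ) → Set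
IsDist {n} {k} D = (∀ S → 0ℚ ≤ D S) × ΣL (allStates n k) D ≡ 1ℚ

IsDistOn : ∀ {n k} → Vec (Fin n) k → Vec (Fin k) k → (State n k → ℚ) → Set
IsDistOn u γ D = IsDist D × (∀ S → 0ℚ < D S → InΩ u γ S)

InDClass : ∀ {n k} → (State n k → ℚ) → Set
InDClass {n} {k} D =
  IsDist D ×
  Σ (Vec (Fin n) k → Vec (Fin k) k → State n k → ℚ) λ Dfam →
    (∀ u γ → distinct u ≡ true → distinct γ ≡ true → IsDistOn u γ (Dfam u γ)) ×
    (∀ S → D S ≡ divQ (ΣL (tuplePairs n k) (λ { (u , γ) → Dfam u γ S }))
                      (ℕtoℚ (length (tuplePairs n k))))

deg : ∀ {n} → Graph n → Fin n → ℕ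
deg {n} G v = sumℕ (map (λ w → if adj G v w then 1 else 0) (allFin n))

totalFitness : ∀ {n k} → (Fin k → ℚ) → State n k → ℚ
totalFitness {n} f S = ΣL (allFin n) (λ u → f (lookup S u))

allEq : ∀ {n k} → Fin k → State n k → Bool
allEq j []       = true
allEq j (x ∷ xs) = does (x ≟ j) ∧ allEq j xs

-- contribution after choosing reproducer v (isolated v: state unchanged;
-- only possible for a connected graph when n = 1)
moveFrom : ∀ {n k} → Graph n → (State n k → ℚ) → State n k → Fin n → ℕ → ℚ
moveFrom G h S v zero    = h S
moveFrom {n} G h S v (suc d) =
  ΣL (allFin n) (λ w → if adj G v w
                        then Data.Rational._/_ (Data.Integer.+_ 1) (suc d) * h (S ∣ v ⇒ w)
                        else 0ℚ)
  where import Data.Integer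

-- fixProbBy G f j t S = Pr(M_t has all vertices of type j | M_0 = S)
fixProbBy : ∀ {n k} → Graph n → (Fin k → ℚ) → Fin k → ℕ → State n k → ℚ
fixProbBy G f j zero    S = if allEq j S then 1ℚ else 0ℚ
fixProbBy {n} G f j (suc t) S =
  ΣL (allFin n) (λ v → divQ (f (lookup S v)) (totalFitness f S)
                        * moveFrom G (fixProbBy G f j t) S v (deg G v))

fixProbByD : ∀ {n k} → Graph n → (Fin k → ℚ) → Fin k → ℕ → (State n k → ℚ) → ℚ
fixProbByD {n} {k} G f j t D = ΣL (allStates n k) (λ S → D S * fixProbBy G f j t S)

-- π_j(G,τ,f,D) ≥ q, where π_j = lim_t Pr(M_t all j) (nondecreasing in t,
-- as all-j states are absorbing)
FixProbAtLeast : ∀ {n k} → Graph n → (Fin k → ℚ) → Fin k → (State n k → ℚ) → ℚ → Set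
FixProbAtLeast G f j D q =
  ∀ (ε : ℚ) → 0ℚ < ε → ∃ λ (t : ℕ) → q ≤ fixProbByD G f j t D + ε

-- Give every vertex the temperature weight ω v = 1/deg v and let the potential of a state S be
-- Σ_u 𝟙[S u = α] ω u.  If v is chosen (with probability ∝ f(S v)) and reproduces onto a uniformly
-- random neighbour w, the potential changes by (𝟙α(S v) − 𝟙α(S w)) ω w with probability ∝ f(S v) ω v.
-- Taking each edge in both directions, the expected change is a nonnegative multiple of
-- Σ_{v~w} ω v ω w (f(S v) − f(S w)) (𝟙α(S v) − 𝟙α(S w)), and every term is ≥ 0 as α is fittest:
-- the potential is a submartingale.  The process is absorbed geometrically fast (within n steps
-- with probability at least q^n), after which the potential is W = Σ ω if α has fixated and 0
-- otherwise; hence W · Pr(α fixated at time m n) ≥ E[potential at time 0] − W (1 − q^n)^m.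
-- For D ∈ 𝒟, each (u, γ) puts α on some coordinate u_i, which is uniformly distributed over the
-- vertices as u ranges over the distinct tuples, so the initial expected potential is ≥ W/n.

module Submission where

open import Defs
open import Data.Bool using (Bool; true; false; if_then_else_)
open import Data.Empty using (⊥-elim)
open import Data.Fin as F using (Fin; zero; suc)
open import Data.Fin.Permutation as Perm using (Permutation′; _⟨$⟩ʳ_; _⟨$⟩ˡ_)
import Data.Fin.Properties as FP
import Data.Integer as ℤ
import Data.Integer.Properties as ℤP
open import Data.List.Membership.Propositional using (_∈_)
open import Data.List.Membership.Propositional.Properties using (∈-allFin)
open import Data.List.Relation.Unary.Any using (here; there)
import Data.List.Properties as LP
open import Data.List using (List; []; _∷_; map; concatMap; allFin; length; filterᵇ; cartesianProduct; _++_)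
open import Data.Vec as V using (Vec; []; _∷_; lookup; _[_]≔_; toList)
import Data.Vec.Properties as VP
open import Data.Nat as ℕ using (ℕ; zero; suc)
import Data.Nat.Coprimality as Coprime
import Data.Nat.Properties as ℕP
open import Data.Product using (_×_; _,_; ∃; ∃₂; proj₁; proj₂)
open import Data.Rational as ℚ using (ℚ; 0ℚ; 1ℚ; mkℚ; _+_; _*_; _-_; -_; _≤_; _<_; _÷_)
import Data.Rational.Properties as ℚP
open import Data.Rational.Solver using (module +-*-Solver)
open import Relation.Binary.Definitions using (tri<; tri≈; tri>)
open import Relation.Binary.PropositionalEquality
open import Relation.Nullary using (Dec; yes; no; does)
open import Relation.Nullary.Decidable using (dec-true; dec-false)
open import Data.Sum using (_⊎_; inj₁; inj₂)

open +-*-Solver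
import Algebra.Properties.CommutativeMonoid.Sum ℚP.+-0-commutativeMonoid as Sum

0≤1 : 0ℚ ≤ 1ℚ
0≤1 = ℚP.<⇒≤ (ℚP.positive⁻¹ 1ℚ)

*-nonNeg : ∀ {p q} → 0ℚ ≤ p → 0ℚ ≤ q → 0ℚ ≤ p * q
*-nonNeg {p} {q} 0≤p 0≤q = ℚP.nonNegative⁻¹ (p * q)
  {{ℚP.nonNeg*nonNeg⇒nonNeg p {{ℚ.nonNegative 0≤p}} q {{ℚ.nonNegative 0≤q}}}}

*-pos : ∀ {p q} → 0ℚ < p → 0ℚ < q → 0ℚ < p * q
*-pos {p} {q} 0<p 0<q = ℚP.positive⁻¹ (p * q) {{ℚP.pos*pos⇒pos p {{ℚ.positive 0<p}} q {{ℚ.positive 0<q}}}}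

*-monoˡ-≤ : ∀ {r p q} → 0ℚ ≤ r → p ≤ q → r * p ≤ r * q
*-monoˡ-≤ {r} 0≤r = ℚP.*-monoˡ-≤-nonNeg r {{ℚ.nonNegative 0≤r}}

*-monoʳ-≤ : ∀ {r p q} → 0ℚ ≤ r → p ≤ q → p * r ≤ q * r
*-monoʳ-≤ {r} 0≤r = ℚP.*-monoʳ-≤-nonNeg r {{ℚ.nonNegative 0≤r}}

*-mono-≤ : ∀ {p q r s} → 0ℚ ≤ p → 0ℚ ≤ s → p ≤ q → r ≤ s → p * r ≤ q * s
*-mono-≤ 0≤p 0≤s p≤q r≤s = ℚP.≤-trans (*-monoˡ-≤ 0≤p r≤s) (*-monoʳ-≤ 0≤s p≤q)

≤⇒0≤- : ∀ {p q} → p ≤ q → 0ℚ ≤ q - p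
≤⇒0≤- {p} {q} p≤q = subst (_≤ q - p) (ℚP.+-inverseʳ p) (ℚP.+-monoˡ-≤ (- p) p≤q)

0≤+⇒0≤ : ∀ {p} → 0ℚ ≤ p + p → 0ℚ ≤ p
0≤+⇒0≤ {p} 0≤2p with ℚP.<-cmp 0ℚ p
... | tri< 0<p _ _ = ℚP.<⇒≤ 0<p
... | tri≈ _ 0≡p _ = ℚP.≤-reflexive 0≡p
... | tri> _ _ p<0 = ⊥-elim (ℚP.<-irrefl refl (ℚP.≤-<-trans 0≤2p (ℚP.+-mono-< p<0 p<0)))

≤∧≢⇒< : ∀ {p} → 0ℚ ≤ p → p ≢ 0ℚ → 0ℚ < p
≤∧≢⇒< 0≤p p≢0 with ℚP.<-cmp 0ℚ _
... | tri< 0<p _ _ = 0<p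
... | tri≈ _ 0≡p _ = ⊥-elim (p≢0 (sym 0≡p))
... | tri> _ _ p<0 = ⊥-elim (ℚP.<-irrefl refl (ℚP.<-≤-trans p<0 0≤p))

divQ≡÷ : ∀ a {b} (0<b : 0ℚ < b) → divQ a b ≡ (a ÷ b) {{ℚ.>-nonZero 0<b}}
divQ≡÷ a {b} 0<b with b ℚ.≟ 0ℚ
... | yes b≡0 = ⊥-elim (ℚP.<-irrefl (sym b≡0) 0<b)
... | no _    = refl

divQ≡*divQ1 : ∀ a {b} → 0ℚ < b → divQ a b ≡ a * divQ 1ℚ b
divQ≡*divQ1 a 0<b rewrite divQ≡÷ a 0<b | divQ≡÷ 1ℚ 0<b =
  cong (a *_) (sym (ℚP.*-identityˡ _))

*-divQ1-inverse : ∀ {b} → 0ℚ < b → b * divQ 1ℚ b ≡ 1ℚ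
*-divQ1-inverse {b} 0<b rewrite divQ≡÷ 1ℚ 0<b =
  trans (cong (b *_) (ℚP.*-identityˡ _)) (ℚP.*-inverseʳ b {{ℚ.>-nonZero 0<b}})

divQ1-pos : ∀ {b} → 0ℚ < b → 0ℚ < divQ 1ℚ b
divQ1-pos {b} 0<b rewrite divQ≡÷ 1ℚ 0<b =
  subst (0ℚ <_) (sym (ℚP.*-identityˡ 1/b)) (ℚP.positive⁻¹ 1/b {{ℚP.1/pos⇒pos b {{ℚ.positive 0<b}}}})
  where 1/b = ℚ.1/_ b {{ℚ.>-nonZero 0<b}}

divQ-nonNeg : ∀ {a b} → 0ℚ ≤ a → 0ℚ ≤ b → 0ℚ ≤ divQ a b
divQ-nonNeg {a} {b} 0≤a 0≤b = by-cases (b ℚ.≟ 0ℚ)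
  where
  by-cases : Dec (b ≡ 0ℚ) → 0ℚ ≤ divQ a b
  by-cases (yes refl) = ℚP.≤-refl
  by-cases (no b≢0)   = subst (0ℚ ≤_) (sym (divQ≡*divQ1 a 0<b)) (*-nonNeg 0≤a (ℚP.<⇒≤ (divQ1-pos 0<b)))
    where 0<b = ≤∧≢⇒< 0≤b b≢0

divQ1-antimono : ∀ {a b} → 0ℚ < a → a ≤ b → divQ 1ℚ b ≤ divQ 1ℚ a
divQ1-antimono {a} {b} 0<a a≤b = begin
  1/b               ≡⟨ sym (ℚP.*-identityˡ 1/b) ⟩
  1ℚ * 1/b          ≡⟨ cong (_* 1/b) (sym (trans (ℚP.*-comm 1/a a) (*-divQ1-inverse 0<a))) ⟩
  1/a * a * 1/b     ≡⟨ ℚP.*-assoc 1/a a 1/b ⟩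
  1/a * (a * 1/b)   ≤⟨ *-monoˡ-≤ (ℚP.<⇒≤ (divQ1-pos 0<a)) (*-monoʳ-≤ (ℚP.<⇒≤ (divQ1-pos 0<b)) a≤b) ⟩
  1/a * (b * 1/b)   ≡⟨ cong (1/a *_) (*-divQ1-inverse 0<b) ⟩
  1/a * 1ℚ          ≡⟨ ℚP.*-identityʳ 1/a ⟩
  1/a               ∎
  where
  open ℚP.≤-Reasoning
  1/a = divQ 1ℚ a
  1/b = divQ 1ℚ b
  0<b = ℚP.<-≤-trans 0<a a≤b

ℕtoℚ-mkℚ : ∀ m → ℕtoℚ m ≡ mkℚ (ℤ.+ m) 0 (Coprime.sym (Coprime.1-coprimeTo m))
ℕtoℚ-mkℚ m = ℚP.↥p/↧p≡p (mkℚ (ℤ.+ m) 0 (Coprime.sym (Coprime.1-coprimeTo m)))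

ℕtoℚ-suc : ∀ m → ℕtoℚ (suc m) ≡ 1ℚ + ℕtoℚ m
ℕtoℚ-suc m = trans (ℚP./-cong {q₁ = 1} {q₂ = 1} (cong (λ z → ℤ.+ 1 ℤ.+ z) (sym (ℤP.*-identityʳ (ℤ.+ m)))) refl)
                   (cong (1ℚ +_) (sym (ℕtoℚ-mkℚ m)))

ℕtoℚ-+ : ∀ a b → ℕtoℚ (a ℕ.+ b) ≡ ℕtoℚ a + ℕtoℚ b
ℕtoℚ-+ zero    b = sym (ℚP.+-identityˡ _)
ℕtoℚ-+ (suc a) b = begin
  ℕtoℚ (suc (a ℕ.+ b))    ≡⟨ ℕtoℚ-suc (a ℕ.+ b) ⟩
  1ℚ + ℕtoℚ (a ℕ.+ b)     ≡⟨ cong (1ℚ +_) (ℕtoℚ-+ a b) ⟩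
  1ℚ + (ℕtoℚ a + ℕtoℚ b)  ≡⟨ sym (ℚP.+-assoc 1ℚ (ℕtoℚ a) (ℕtoℚ b)) ⟩
  1ℚ + ℕtoℚ a + ℕtoℚ b    ≡⟨ cong (_+ ℕtoℚ b) (sym (ℕtoℚ-suc a)) ⟩
  ℕtoℚ (suc a) + ℕtoℚ b   ∎
  where open ≡-Reasoning

ℕtoℚ-nonNeg : ∀ m → 0ℚ ≤ ℕtoℚ m
ℕtoℚ-nonNeg zero    = ℚP.≤-refl
ℕtoℚ-nonNeg (suc m) = subst (0ℚ ≤_) (sym (ℕtoℚ-suc m)) (ℚP.+-mono-≤ 0≤1 (ℕtoℚ-nonNeg m))

ℕtoℚ-mono-≤ : ∀ {a b} → a ℕ.≤ b → ℕtoℚ a ≤ ℕtoℚ b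
ℕtoℚ-mono-≤ {a} a≤b with ℕP.m≤n⇒∃[o]m+o≡n a≤b
... | o , refl = subst (ℕtoℚ a ≤_) (sym (ℕtoℚ-+ a o))
  (ℚP.≤-trans (ℚP.≤-reflexive (sym (ℚP.+-identityʳ (ℕtoℚ a)))) (ℚP.+-monoʳ-≤ (ℕtoℚ a) (ℕtoℚ-nonNeg o)))

ℕtoℚ-suc-pos : ∀ m → 0ℚ < ℕtoℚ (suc m)
ℕtoℚ-suc-pos m = ℚP.<-≤-trans (ℚP.positive⁻¹ 1ℚ) (ℕtoℚ-mono-≤ {1} {suc m} (ℕ.s≤s ℕ.z≤n))

ℕtoℚ-archimedean : ∀ r → ∃ λ m → r ≤ ℕtoℚ m
ℕtoℚ-archimedean r@(mkℚ (ℤ.+ a) d _) = a , subst (r ≤_) (sym (ℕtoℚ-mkℚ a))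
  (ℚ.*≤* (subst₂ ℤ._≤_ (ℤP.pos-* a 1) (ℤP.pos-* a (suc d)) (ℤ.+≤+ (ℕP.*-monoʳ-≤ a (ℕ.s≤s ℕ.z≤n)))))
ℕtoℚ-archimedean r@(mkℚ ℤ.-[1+ _ ] _ _) = 0 , ℚP.<⇒≤ (ℚP.negative⁻¹ r)

1/suc : ℕ → ℚ
1/suc d = ℤ.+ 1 ℚ./ suc d

1/suc-inverse : ∀ d → 1/suc d * ℕtoℚ (suc d) ≡ 1ℚ
1/suc-inverse d = trans (cong₂ _*_ (ℚP.↥p/↧p≡p p) (ℕtoℚ-mkℚ (suc d)))
                        (trans (ℚP.*-comm p q) (ℚP.*-inverseʳ q))
  where
  p = mkℚ (ℤ.+ 1) d (Coprime.1-coprimeTo (suc d))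
  q = mkℚ (ℤ.+ suc d) 0 (Coprime.sym (Coprime.1-coprimeTo (suc d)))

1/suc-pos : ∀ d → 0ℚ < 1/suc d
1/suc-pos d = subst (0ℚ <_) (sym (ℚP.↥p/↧p≡p (mkℚ (ℤ.+ 1) d (Coprime.1-coprimeTo (suc d)))))
                    (ℚ.*<* (ℤ.+<+ (ℕ.s≤s ℕ.z≤n)))

1/suc≡divQ1 : ∀ d → 1/suc d ≡ divQ 1ℚ (ℕtoℚ (suc d))
1/suc≡divQ1 d = begin
  x                ≡⟨ sym (ℚP.*-identityʳ x) ⟩
  x * 1ℚ           ≡⟨ cong (x *_) (sym (*-divQ1-inverse (ℕtoℚ-suc-pos d))) ⟩
  x * (m * 1/m)    ≡⟨ sym (ℚP.*-assoc x m 1/m) ⟩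
  (x * m) * 1/m    ≡⟨ cong (_* 1/m) (1/suc-inverse d) ⟩
  1ℚ * 1/m         ≡⟨ ℚP.*-identityˡ 1/m ⟩
  1/m              ∎
  where
  open ≡-Reasoning
  x = 1/suc d
  m = ℕtoℚ (suc d)
  1/m = divQ 1ℚ m

infixr 8 _^_

_^_ : ℚ → ℕ → ℚ
p ^ zero  = 1ℚ
p ^ suc t = p * p ^ t

^-nonNeg : ∀ {p} → 0ℚ ≤ p → ∀ t → 0ℚ ≤ p ^ t
^-nonNeg 0≤p zero    = 0≤1
^-nonNeg 0≤p (suc t) = *-nonNeg 0≤p (^-nonNeg 0≤p t)

^-pos : ∀ {p} → 0ℚ < p → ∀ t → 0ℚ < p ^ t
^-pos 0<p zero    = ℚP.positive⁻¹ 1ℚ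
^-pos 0<p (suc t) = *-pos 0<p (^-pos 0<p t)

^-≤1 : ∀ {p} → 0ℚ ≤ p → p ≤ 1ℚ → ∀ t → p ^ t ≤ 1ℚ
^-≤1 0≤p p≤1 zero    = ℚP.≤-refl
^-≤1 0≤p p≤1 (suc t) = ℚP.≤-trans (*-mono-≤ 0≤p 0≤1 p≤1 (^-≤1 0≤p p≤1 t)) (ℚP.≤-reflexive (ℚP.*-identityˡ 1ℚ))

bernoulli : ∀ {δ} → 0ℚ ≤ δ → 0ℚ ≤ 1ℚ - δ → ∀ m → (1ℚ - δ) ^ m * (1ℚ + ℕtoℚ m * δ) ≤ 1ℚ
bernoulli {δ} 0≤δ 0≤1-δ zero = ℚP.≤-reflexive (solve 1 (λ d → con 1ℚ :* (con 1ℚ :+ con 0ℚ :* d) := con 1ℚ) refl δ)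
bernoulli {δ} 0≤δ 0≤1-δ (suc m) = begin
  (1ℚ - δ) ^ suc m * (1ℚ + ℕtoℚ (suc m) * δ)
    ≡⟨ cong (λ z → (1ℚ - δ) ^ suc m * (1ℚ + z * δ)) (ℕtoℚ-suc m) ⟩
  (1ℚ - δ) * X * (1ℚ + (1ℚ + M) * δ)
    ≡⟨ solve 3 (λ d x m → (con 1ℚ :- d) :* x :* (con 1ℚ :+ (con 1ℚ :+ m) :* d)
                          := x :* (con 1ℚ :+ m :* d) :- x :* (d :* d :* (con 1ℚ :+ m))) refl δ X M ⟩
  X * (1ℚ + M * δ) - X * (δ * δ * (1ℚ + M))
    ≤⟨ ℚP.+-monoʳ-≤ (X * (1ℚ + M * δ)) (ℚP.neg-antimono-≤ loss-nonNeg) ⟩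
  X * (1ℚ + M * δ) - 0ℚ
    ≡⟨ ℚP.+-identityʳ (X * (1ℚ + M * δ)) ⟩
  X * (1ℚ + M * δ)
    ≤⟨ bernoulli 0≤δ 0≤1-δ m ⟩
  1ℚ ∎
  where
  open ℚP.≤-Reasoning
  X = (1ℚ - δ) ^ m
  M = ℕtoℚ m
  loss-nonNeg : 0ℚ ≤ X * (δ * δ * (1ℚ + M))
  loss-nonNeg = *-nonNeg (^-nonNeg 0≤1-δ m) (*-nonNeg (*-nonNeg 0≤δ 0≤δ) (ℚP.+-mono-≤ 0≤1 (ℕtoℚ-nonNeg m)))

^-eventually-≤ : ∀ {δ ε} → 0ℚ < δ → 0ℚ ≤ 1ℚ - δ → 0ℚ < ε → ∃ λ m → (1ℚ - δ) ^ m ≤ ε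
^-eventually-≤ {δ} {ε} 0<δ 0≤1-δ 0<ε with ℕtoℚ-archimedean (divQ 1ℚ (ε * δ))
... | m , 1/εδ≤m = m , ℚP.*-cancelʳ-≤-pos Z {{ℚ.positive 0<Z}}
                         (ℚP.≤-trans (bernoulli (ℚP.<⇒≤ 0<δ) 0≤1-δ m) 1≤εZ)
  where
  M = ℕtoℚ m
  Z = 1ℚ + M * δ
  0≤Mδ = *-nonNeg (ℕtoℚ-nonNeg m) (ℚP.<⇒≤ 0<δ)
  0<Z : 0ℚ < Z
  0<Z = ℚP.<-≤-trans (ℚP.positive⁻¹ 1ℚ) (subst (_≤ Z) (ℚP.+-identityʳ 1ℚ) (ℚP.+-monoʳ-≤ 1ℚ 0≤Mδ))
  0<εδ = *-pos 0<ε 0<δ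
  1≤εZ : 1ℚ ≤ ε * Z
  1≤εZ = begin
    1ℚ                            ≡⟨ sym (*-divQ1-inverse 0<εδ) ⟩
    (ε * δ) * divQ 1ℚ (ε * δ)     ≤⟨ *-monoˡ-≤ (ℚP.<⇒≤ 0<εδ) 1/εδ≤m ⟩
    (ε * δ) * M                   ≡⟨ solve 3 (λ e d m → e :* d :* m := con 0ℚ :+ e :* (m :* d)) refl ε δ M ⟩
    0ℚ + ε * (M * δ)              ≤⟨ ℚP.+-monoˡ-≤ (ε * (M * δ)) (ℚP.<⇒≤ 0<ε) ⟩
    ε + ε * (M * δ)               ≡⟨ solve 2 (λ e x → e :+ e :* x := e :* (con 1ℚ :+ x)) refl ε (M * δ) ⟩
    ε * Z                         ∎
    where open ℚP.≤-Reasoning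

module _ {A : Set} where

  ΣL-cong : (xs : List A) {g h : A → ℚ} → (∀ x → g x ≡ h x) → ΣL xs g ≡ ΣL xs h
  ΣL-cong []       g≗h = refl
  ΣL-cong (x ∷ xs) g≗h = cong₂ _+_ (g≗h x) (ΣL-cong xs g≗h)

  ΣL-+ : (xs : List A) (g h : A → ℚ) → ΣL xs (λ x → g x + h x) ≡ ΣL xs g + ΣL xs h
  ΣL-+ []       g h = refl
  ΣL-+ (x ∷ xs) g h rewrite ΣL-+ xs g h =
    solve 4 (λ a b c d → (a :+ b) :+ (c :+ d) := (a :+ c) :+ (b :+ d)) refl (g x) (h x) (ΣL xs g) (ΣL xs h)

  ΣL-* : (xs : List A) (c : ℚ) (g : A → ℚ) → ΣL xs (λ x → c * g x) ≡ c * ΣL xs g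
  ΣL-* []       c g = sym (ℚP.*-zeroʳ c)
  ΣL-* (x ∷ xs) c g rewrite ΣL-* xs c g = sym (ℚP.*-distribˡ-+ c (g x) (ΣL xs g))

  ΣL-zero : (xs : List A) → ΣL xs (λ _ → 0ℚ) ≡ 0ℚ
  ΣL-zero []       = refl
  ΣL-zero (x ∷ xs) rewrite ΣL-zero xs = refl

  ΣL-mono : (xs : List A) {g h : A → ℚ} → (∀ x → g x ≤ h x) → ΣL xs g ≤ ΣL xs h
  ΣL-mono []       g≤h = ℚP.≤-refl
  ΣL-mono (x ∷ xs) g≤h = ℚP.+-mono-≤ (g≤h x) (ΣL-mono xs g≤h)

  ΣL-nonNeg : (xs : List A) {g : A → ℚ} → (∀ x → 0ℚ ≤ g x) → 0ℚ ≤ ΣL xs g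
  ΣL-nonNeg xs {g} 0≤g = subst (_≤ ΣL xs g) (ΣL-zero xs) (ΣL-mono xs 0≤g)

  term≤ΣL : (xs : List A) {g : A → ℚ} → (∀ x → 0ℚ ≤ g x) → ∀ {y} → y ∈ xs → g y ≤ ΣL xs g
  term≤ΣL (x ∷ xs) {g} 0≤g (here refl) =
    subst (_≤ ΣL (x ∷ xs) g) (ℚP.+-identityʳ (g x)) (ℚP.+-monoʳ-≤ (g x) (ΣL-nonNeg xs 0≤g))
  term≤ΣL (x ∷ xs) {g} 0≤g (there y∈xs) =
    subst (_≤ ΣL (x ∷ xs) g) (ℚP.+-identityˡ (g _)) (ℚP.+-mono-≤ (0≤g x) (term≤ΣL xs 0≤g y∈xs))

  ΣL-++ : (xs ys : List A) (g : A → ℚ) → ΣL (xs ++ ys) g ≡ ΣL xs g + ΣL ys g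
  ΣL-++ []       ys g = sym (ℚP.+-identityˡ _)
  ΣL-++ (x ∷ xs) ys g rewrite ΣL-++ xs ys g = sym (ℚP.+-assoc (g x) _ _)

  ΣL-filterᵇ : (p : A → Bool) (xs : List A) (g : A → ℚ) →
               ΣL (filterᵇ p xs) g ≡ ΣL xs (λ x → if p x then g x else 0ℚ)
  ΣL-filterᵇ p []       g = refl
  ΣL-filterᵇ p (x ∷ xs) g with p x
  ... | true  = cong (g x +_) (ΣL-filterᵇ p xs g)
  ... | false = trans (ΣL-filterᵇ p xs g) (sym (ℚP.+-identityˡ _))

  ΣL-1 : (xs : List A) → ΣL xs (λ _ → 1ℚ) ≡ ℕtoℚ (length xs)
  ΣL-1 []       = refl
  ΣL-1 (x ∷ xs) = trans (cong (1ℚ +_) (ΣL-1 xs)) (sym (ℕtoℚ-suc (length xs)))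

  ΣL-const : (xs : List A) (c : ℚ) → ΣL xs (λ _ → c) ≡ c * ℕtoℚ (length xs)
  ΣL-const xs c = begin
    ΣL xs (λ _ → c)        ≡⟨ ΣL-cong xs (λ _ → sym (ℚP.*-identityʳ c)) ⟩
    ΣL xs (λ _ → c * 1ℚ)   ≡⟨ ΣL-* xs c (λ _ → 1ℚ) ⟩
    c * ΣL xs (λ _ → 1ℚ)   ≡⟨ cong (c *_) (ΣL-1 xs) ⟩
    c * ℕtoℚ (length xs)   ∎
    where open ≡-Reasoning

  ΣL-sumℕ : (xs : List A) (g : A → ℕ) → ℕtoℚ (sumℕ (map g xs)) ≡ ΣL xs (λ x → ℕtoℚ (g x))
  ΣL-sumℕ []       g = refl
  ΣL-sumℕ (x ∷ xs) g = trans (ℕtoℚ-+ (g x) _) (cong (ℕtoℚ (g x) +_) (ΣL-sumℕ xs g))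

ΣL-map : ∀ {A B : Set} (e : A → B) (xs : List A) (g : B → ℚ) → ΣL (map e xs) g ≡ ΣL xs (λ x → g (e x))
ΣL-map e []       g = refl
ΣL-map e (x ∷ xs) g = cong (g (e x) +_) (ΣL-map e xs g)

module _ {A B : Set} where

  ΣL-concatMap : (F : A → List B) (xs : List A) (g : B → ℚ) →
                 ΣL (concatMap F xs) g ≡ ΣL xs (λ x → ΣL (F x) g)
  ΣL-concatMap F []       g = refl
  ΣL-concatMap F (x ∷ xs) g =
    trans (ΣL-++ (F x) (concatMap F xs) g) (cong (ΣL (F x) g +_) (ΣL-concatMap F xs g))

  ΣL-swap : (xs : List A) (ys : List B) (g : A → B → ℚ) →
            ΣL xs (λ x → ΣL ys (g x)) ≡ ΣL ys (λ y → ΣL xs (λ x → g x y))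
  ΣL-swap []       ys g = sym (ΣL-zero ys)
  ΣL-swap (x ∷ xs) ys g = trans (cong (ΣL ys (g x) +_) (ΣL-swap xs ys g))
                                (sym (ΣL-+ ys (g x) (λ y → ΣL xs (λ x → g x y))))

  ΣL-cartesianProduct : (xs : List A) (ys : List B) (g : A × B → ℚ) →
                        ΣL (cartesianProduct xs ys) g ≡ ΣL xs (λ x → ΣL ys (λ y → g (x , y)))
  ΣL-cartesianProduct []       ys g = refl
  ΣL-cartesianProduct (x ∷ xs) ys g =
    trans (ΣL-++ (map (x ,_) ys) _ g) (cong₂ _+_ (ΣL-map (x ,_) ys g) (ΣL-cartesianProduct xs ys g))

ΣL-allFin-suc : ∀ n (g : Fin (suc n) → ℚ) → ΣL (allFin (suc n)) g ≡ g zero + ΣL (allFin n) (λ i → g (suc i))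
ΣL-allFin-suc n g = cong (g zero +_) (trans (cong (λ l → ΣL l g) (sym (LP.map-tabulate {n = n} (λ i → i) suc)))
                                            (ΣL-map suc (allFin n) g))

ΣL-[]≔ : ∀ {m k} (S : Vec (Fin k) m) (w : Fin m) (x : Fin k) (g : Fin k → Fin m → ℚ) →
         ΣL (allFin m) (λ u → g (lookup (S [ w ]≔ x) u) u) + g (lookup S w) w
         ≡ ΣL (allFin m) (λ u → g (lookup S u) u) + g x w
ΣL-[]≔ {suc m} (y ∷ ys) zero x g = begin
  ΣL (allFin (suc m)) (λ u → g (lookup (x ∷ ys) u) u) + g y zero
    ≡⟨ cong (_+ g y zero) (ΣL-allFin-suc m (λ u → g (lookup (x ∷ ys) u) u)) ⟩
  (g x zero + R) + g y zero
    ≡⟨ solve 3 (λ a r b → (a :+ r) :+ b := (b :+ r) :+ a) refl (g x zero) R (g y zero) ⟩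
  (g y zero + R) + g x zero
    ≡⟨ cong (_+ g x zero) (sym (ΣL-allFin-suc m (λ u → g (lookup (y ∷ ys) u) u))) ⟩
  ΣL (allFin (suc m)) (λ u → g (lookup (y ∷ ys) u) u) + g x zero ∎
  where
  open ≡-Reasoning
  R = ΣL (allFin m) (λ u → g (lookup ys u) (suc u))
ΣL-[]≔ {suc m} (y ∷ ys) (suc w) x g = begin
  ΣL (allFin (suc m)) (λ u → g (lookup (y ∷ (ys [ w ]≔ x)) u) u) + g (lookup ys w) (suc w)
    ≡⟨ cong (_+ g (lookup ys w) (suc w)) (ΣL-allFin-suc m (λ u → g (lookup (y ∷ (ys [ w ]≔ x)) u) u)) ⟩
  (g y zero + R′) + g (lookup ys w) (suc w)  ≡⟨ ℚP.+-assoc (g y zero) R′ _ ⟩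
  g y zero + (R′ + g (lookup ys w) (suc w))  ≡⟨ cong (g y zero +_) (ΣL-[]≔ ys w x (λ t u → g t (suc u))) ⟩
  g y zero + (R + g x (suc w))               ≡⟨ sym (ℚP.+-assoc (g y zero) R _) ⟩
  (g y zero + R) + g x (suc w)
    ≡⟨ cong (_+ g x (suc w)) (sym (ΣL-allFin-suc m (λ u → g (lookup (y ∷ ys) u) u))) ⟩
  ΣL (allFin (suc m)) (λ u → g (lookup (y ∷ ys) u) u) + g x (suc w) ∎
  where
  open ≡-Reasoning
  R′ = ΣL (allFin m) (λ u → g (lookup (ys [ w ]≔ x) u) (suc u))
  R  = ΣL (allFin m) (λ u → g (lookup ys u) (suc u))

ΣL-allFin≡sum : ∀ n (g : Fin n → ℚ) → ΣL (allFin n) g ≡ Sum.sum g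
ΣL-allFin≡sum zero    g = refl
ΣL-allFin≡sum (suc n) g = trans (ΣL-allFin-suc n g) (cong (g zero +_) (ΣL-allFin≡sum n (λ i → g (suc i))))

ΣL-allFin-permute : ∀ {n} (π : Permutation′ n) (g : Fin n → ℚ) →
                    ΣL (allFin n) (λ i → g (π ⟨$⟩ʳ i)) ≡ ΣL (allFin n) g
ΣL-allFin-permute {n} π g = begin
  ΣL (allFin n) (λ i → g (π ⟨$⟩ʳ i))   ≡⟨ ΣL-allFin≡sum n _ ⟩
  Sum.sum (λ i → g (π ⟨$⟩ʳ i))          ≡⟨ sym (Sum.sum-permute g π) ⟩
  Sum.sum g                             ≡⟨ sym (ΣL-allFin≡sum n g) ⟩
  ΣL (allFin n) g                       ∎
  where open ≡-Reasoning

ΣL-indicator : ∀ n (z : Fin n) (c : ℚ) → ΣL (allFin n) (λ x → if does (x F.≟ z) then c else 0ℚ) ≡ c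
ΣL-indicator (suc n) zero c = begin
  ΣL (allFin (suc n)) (λ x → if does (x F.≟ zero) then c else 0ℚ) ≡⟨ ΣL-allFin-suc n (λ x → if does (x F.≟ zero) then c else 0ℚ) ⟩
  c + ΣL (allFin n) (λ x → 0ℚ)                                      ≡⟨ cong (c +_) (ΣL-zero (allFin n)) ⟩
  c + 0ℚ                                                            ≡⟨ ℚP.+-identityʳ c ⟩
  c                                                                 ∎
  where open ≡-Reasoning
ΣL-indicator (suc n) (suc z) c = begin
  ΣL (allFin (suc n)) (λ x → if does (x F.≟ suc z) then c else 0ℚ)       ≡⟨ ΣL-allFin-suc n (λ x → if does (x F.≟ suc z) then c else 0ℚ) ⟩
  0ℚ + ΣL (allFin n) (λ x → if does (suc x F.≟ suc z) then c else 0ℚ)   ≡⟨ ℚP.+-identityˡ _ ⟩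
  ΣL (allFin n) (λ x → if does (suc x F.≟ suc z) then c else 0ℚ)        ≡⟨ ΣL-cong (allFin n) suc-≟ ⟩
  ΣL (allFin n) (λ x → if does (x F.≟ z) then c else 0ℚ)                ≡⟨ ΣL-indicator n z c ⟩
  c                                                                     ∎
  where
  open ≡-Reasoning
  suc-≟ : ∀ x → (if does (suc x F.≟ suc z) then c else 0ℚ) ≡ (if does (x F.≟ z) then c else 0ℚ)
  suc-≟ x with x F.≟ z
  ... | yes _ = refl
  ... | no _  = refl

sumℕ-∈ : ∀ {A : Set} (g : A → ℕ) {xs : List A} {x} → x ∈ xs → g x ℕ.≤ sumℕ (map g xs)
sumℕ-∈ g {x ∷ xs} (here refl)  = ℕP.m≤m+n (g x) _
sumℕ-∈ g {y ∷ xs} (there x∈xs) = ℕP.≤-trans (sumℕ-∈ g x∈xs) (ℕP.m≤n+m _ (g y))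

sumℕ-indicator≤length : ∀ {A : Set} (p : A → Bool) (xs : List A) →
                        sumℕ (map (λ x → if p x then 1 else 0) xs) ℕ.≤ length xs
sumℕ-indicator≤length p []       = ℕ.z≤n
sumℕ-indicator≤length p (x ∷ xs) with p x
... | true  = ℕ.s≤s (sumℕ-indicator≤length p xs)
... | false = ℕP.m≤n⇒m≤1+n (sumℕ-indicator≤length p xs)

module _ {n : ℕ} (G : Graph n) where

  adj⇒1≤deg : ∀ v w → adj G v w ≡ true → 1 ℕ.≤ deg G v
  adj⇒1≤deg v w v~w = subst (λ b → (if b then 1 else 0) ℕ.≤ deg G v) v~w
    (sumℕ-∈ (λ w → if adj G v w then 1 else 0) (∈-allFin w))

  deg≡0⇒¬adj : ∀ v w → deg G v ≡ 0 → adj G v w ≡ false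
  deg≡0⇒¬adj v w deg≡0 with adj G v w in v~w
  ... | true  = ⊥-elim (ℕP.<⇒≢ (subst (1 ℕ.≤_) deg≡0 (adj⇒1≤deg v w v~w)) refl)
  ... | false = refl

  deg≤n : ∀ v → deg G v ℕ.≤ n
  deg≤n v = subst (deg G v ℕ.≤_) (LP.length-tabulate {n = n} (λ i → i)) (sumℕ-indicator≤length (adj G v) (allFin n))

module _ {k : ℕ} where

  allEq⇒lookup : ∀ {m} (c : Fin k) (S : Vec (Fin k) m) → allEq c S ≡ true → ∀ u → lookup S u ≡ c
  allEq⇒lookup c (x ∷ S) eq u with x F.≟ c
  allEq⇒lookup c (x ∷ S) eq zero    | yes x≡c = x≡c
  allEq⇒lookup c (x ∷ S) eq (suc u) | yes _   = allEq⇒lookup c S eq u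

  lookup⇒allEq : ∀ {m} (c : Fin k) (S : Vec (Fin k) m) → (∀ u → lookup S u ≡ c) → allEq c S ≡ true
  lookup⇒allEq c []      _    = refl
  lookup⇒allEq c (x ∷ S) S≡c rewrite dec-true (x F.≟ c) (S≡c zero) = lookup⇒allEq c S (λ u → S≡c (suc u))

  monochromatic? : ∀ {m} (c : Fin k) (S : Vec (Fin k) m) → (∀ u → lookup S u ≡ c) ⊎ (∃ λ u → lookup S u ≢ c)
  monochromatic? c []      = inj₁ (λ ())
  monochromatic? c (x ∷ S) with x F.≟ c | monochromatic? c S
  ... | no x≢c  | _             = inj₂ (zero , x≢c)
  ... | yes _   | inj₂ (u , Su≢c) = inj₂ (suc u , Su≢c)
  ... | yes x≡c | inj₁ S≡c      = inj₁ λ { zero → x≡c ; (suc u) → S≡c u }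

  monochromatic-move : ∀ {m} (c : Fin k) (S : Vec (Fin k) m) → (∀ u → lookup S u ≡ c) → ∀ v w → S ∣ v ⇒ w ≡ S
  monochromatic-move c S S≡c v w = trans (cong (S [ w ]≔_) (trans (S≡c v) (sym (S≡c w)))) (VP.[]≔-lookup S w)

  mismatches : ∀ {m} → Fin k → Vec (Fin k) m → ℕ
  mismatches c []       = 0
  mismatches c (x ∷ xs) = (if does (x F.≟ c) then 0 else 1) ℕ.+ mismatches c xs

  mismatches≡0 : ∀ {m} (c : Fin k) (S : Vec (Fin k) m) → mismatches c S ≡ 0 → ∀ u → lookup S u ≡ c
  mismatches≡0 c (x ∷ S) eq u with x F.≟ c
  mismatches≡0 c (x ∷ S) eq zero    | yes x≡c = x≡c
  mismatches≡0 c (x ∷ S) eq (suc u) | yes _   = mismatches≡0 c S eq u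

  mismatches≤length : ∀ {m} (c : Fin k) (S : Vec (Fin k) m) → mismatches c S ℕ.≤ m
  mismatches≤length c []      = ℕ.z≤n
  mismatches≤length c (x ∷ S) with x F.≟ c
  ... | yes _ = ℕP.m≤n⇒m≤1+n (mismatches≤length c S)
  ... | no _  = ℕ.s≤s (mismatches≤length c S)

  mismatches-[]≔ : ∀ {m} (c : Fin k) (S : Vec (Fin k) m) w → lookup S w ≢ c →
                   suc (mismatches c (S [ w ]≔ c)) ≡ mismatches c S
  mismatches-[]≔ c (x ∷ S) zero    x≢c rewrite dec-true (c F.≟ c) refl | dec-false (x F.≟ c) x≢c = refl
  mismatches-[]≔ c (x ∷ S) (suc w) Sw≢c =
    trans (sym (ℕP.+-suc (if does (x F.≟ c) then 0 else 1) _))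
          (cong ((if does (x F.≟ c) then 0 else 1) ℕ.+_) (mismatches-[]≔ c S w Sw≢c))

  lookup-[]≔-same : ∀ {m} (c : Fin k) (S : Vec (Fin k) m) u w → lookup S u ≡ c → lookup (S [ w ]≔ c) u ≡ c
  lookup-[]≔-same c (x ∷ S) zero    zero    _    = refl
  lookup-[]≔-same c (x ∷ S) zero    (suc w) Su≡c = Su≡c
  lookup-[]≔-same c (x ∷ S) (suc u) zero    Su≡c = Su≡c
  lookup-[]≔-same c (x ∷ S) (suc u) (suc w) Su≡c = lookup-[]≔-same c S u w Su≡c

  walk-boundary-edge : ∀ {m} {G : Graph m} {a u} → Walk G a u → ∀ (S : Vec (Fin k) m) c →
    lookup S a ≡ c → lookup S u ≢ c → ∃₂ λ v w → adj G v w ≡ true × lookup S v ≡ c × lookup S w ≢ c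
  walk-boundary-edge here S c Sa≡c Su≢c = ⊥-elim (Su≢c Sa≡c)
  walk-boundary-edge {a = a} (there {v = b} a~b walk) S c Sa≡c Su≢c with lookup S b F.≟ c
  ... | yes Sb≡c = walk-boundary-edge walk S c Sb≡c Su≢c
  ... | no Sb≢c  = a , b , a~b , Sa≡c , Sb≢c

-- One step of the Moran process

module MoranStep {n′ k : ℕ} (G : Graph (suc n′)) (f : Fin k → ℚ) (1≤f : ∀ i → 1ℚ ≤ f i) where

  n : ℕ
  n = suc n′

  Ω : Set
  Ω = State n k

  reproductionProb : Ω → Fin n → ℚ
  reproductionProb S v = divQ (f (lookup S v)) (totalFitness f S)

  step : (Ω → ℚ) → Ω → ℚ
  step h S = ΣL (allFin n) (λ v → reproductionProb S v * moveFrom G h S v (deg G v))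

  evolve : ℕ → (Ω → ℚ) → Ω → ℚ
  evolve zero    h = h
  evolve (suc t) h = step (evolve t h)

  1≤f⇒0≤f : ∀ i → 0ℚ ≤ f i
  1≤f⇒0≤f i = ℚP.≤-trans 0≤1 (1≤f i)

  totalFitness-pos : ∀ S → 0ℚ < totalFitness f S
  totalFitness-pos S = ℚP.<-≤-trans (ℚP.positive⁻¹ 1ℚ) (ℚP.≤-trans (1≤f (lookup S zero))
    (term≤ΣL (allFin n) (λ u → 1≤f⇒0≤f (lookup S u)) (∈-allFin zero)))

  reproductionProb-nonNeg : ∀ S v → 0ℚ ≤ reproductionProb S v
  reproductionProb-nonNeg S v = divQ-nonNeg (1≤f⇒0≤f _) (ℚP.<⇒≤ (totalFitness-pos S))

  ΣL-reproductionProb : ∀ S → ΣL (allFin n) (reproductionProb S) ≡ 1ℚ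
  ΣL-reproductionProb S = begin
    ΣL (allFin n) (reproductionProb S)           ≡⟨ ΣL-cong (allFin n) (λ v → trans (divQ≡*divQ1 (fS v) (totalFitness-pos S)) (ℚP.*-comm (fS v) 1/T)) ⟩
    ΣL (allFin n) (λ v → 1/T * fS v)             ≡⟨ ΣL-* (allFin n) 1/T fS ⟩
    1/T * totalFitness f S                       ≡⟨ ℚP.*-comm 1/T _ ⟩
    totalFitness f S * 1/T                       ≡⟨ *-divQ1-inverse (totalFitness-pos S) ⟩
    1ℚ                                           ∎
    where
    open ≡-Reasoning
    fS = λ v → f (lookup S v)
    1/T = divQ 1ℚ (totalFitness f S)

  ΣL-reproductionProb-* : ∀ (c : ℚ) S → ΣL (allFin n) (λ v → reproductionProb S v * c) ≡ c
  ΣL-reproductionProb-* c S = begin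
    ΣL (allFin n) (λ v → reproductionProb S v * c) ≡⟨ ΣL-cong (allFin n) (λ v → ℚP.*-comm (reproductionProb S v) c) ⟩
    ΣL (allFin n) (λ v → c * reproductionProb S v) ≡⟨ ΣL-* (allFin n) c (reproductionProb S) ⟩
    c * ΣL (allFin n) (reproductionProb S)         ≡⟨ cong (c *_) (ΣL-reproductionProb S) ⟩
    c * 1ℚ                                         ≡⟨ ℚP.*-identityʳ c ⟩
    c                                              ∎
    where open ≡-Reasoning

  deg≡ΣL : ∀ v → ℕtoℚ (deg G v) ≡ ΣL (allFin n) (λ w → if adj G v w then 1ℚ else 0ℚ)
  deg≡ΣL v = trans (ΣL-sumℕ (allFin n) (λ w → if adj G v w then 1 else 0))
                   (ΣL-cong (allFin n) (λ w → ℕtoℚ-if (adj G v w)))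
    where
    ℕtoℚ-if : ∀ b → ℕtoℚ (if b then 1 else 0) ≡ (if b then 1ℚ else 0ℚ)
    ℕtoℚ-if true  = refl
    ℕtoℚ-if false = refl

  module _ (S : Ω) (v : Fin n) where

    moveFrom-cong : ∀ d {h g : Ω → ℚ} → (∀ S → h S ≡ g S) → moveFrom G h S v d ≡ moveFrom G g S v d
    moveFrom-cong zero    h≗g = h≗g S
    moveFrom-cong (suc d) h≗g = ΣL-cong (allFin n) λ w →
      cong (λ z → if adj G v w then 1/suc d * z else 0ℚ) (h≗g (S ∣ v ⇒ w))

    moveFrom-linear : ∀ d a (h g : Ω → ℚ) →
      moveFrom G (λ S → a * h S + g S) S v d ≡ a * moveFrom G h S v d + moveFrom G g S v d
    moveFrom-linear zero    a h g = refl
    moveFrom-linear (suc d) a h g = begin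
      ΣL (allFin n) (λ w → if adj G v w then c * (a * h (S ∣ v ⇒ w) + g (S ∣ v ⇒ w)) else 0ℚ)
        ≡⟨ ΣL-cong (allFin n) (λ w → split (adj G v w) (h (S ∣ v ⇒ w)) (g (S ∣ v ⇒ w))) ⟩
      ΣL (allFin n) (λ w → a * H w + Gw w)       ≡⟨ ΣL-+ (allFin n) (λ w → a * H w) Gw ⟩
      ΣL (allFin n) (λ w → a * H w) + ΣL (allFin n) Gw
        ≡⟨ cong (_+ ΣL (allFin n) Gw) (ΣL-* (allFin n) a H) ⟩
      a * ΣL (allFin n) H + ΣL (allFin n) Gw     ∎
      where
      open ≡-Reasoning
      c = 1/suc d
      H = λ w → if adj G v w then c * h (S ∣ v ⇒ w) else 0ℚ
      Gw = λ w → if adj G v w then c * g (S ∣ v ⇒ w) else 0ℚ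
      split : ∀ b x y → (if b then c * (a * x + y) else 0ℚ)
                        ≡ a * (if b then c * x else 0ℚ) + (if b then c * y else 0ℚ)
      split true  x y = solve 4 (λ c a x y → c :* (a :* x :+ y) := a :* (c :* x) :+ c :* y) refl c a x y
      split false x y = solve 1 (λ a → con 0ℚ := a :* con 0ℚ :+ con 0ℚ) refl a

    moveFrom-mono : ∀ d {h g : Ω → ℚ} → (∀ S → h S ≤ g S) → moveFrom G h S v d ≤ moveFrom G g S v d
    moveFrom-mono zero    h≤g = h≤g S
    moveFrom-mono (suc d) {h} {g} h≤g = ΣL-mono (allFin n) (λ w → along-edge (adj G v w) w)
      where
      along-edge : ∀ b w → (if b then 1/suc d * h (S ∣ v ⇒ w) else 0ℚ)
                           ≤ (if b then 1/suc d * g (S ∣ v ⇒ w) else 0ℚ)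
      along-edge true  w = *-monoˡ-≤ (ℚP.<⇒≤ (1/suc-pos d)) (h≤g (S ∣ v ⇒ w))
      along-edge false w = ℚP.≤-refl

    edge-term-nonNeg : ∀ d {h : Ω → ℚ} → (∀ S → 0ℚ ≤ h S) → ∀ w →
      0ℚ ≤ (if adj G v w then 1/suc d * h (S ∣ v ⇒ w) else 0ℚ)
    edge-term-nonNeg d 0≤h w with adj G v w
    ... | true  = *-nonNeg (ℚP.<⇒≤ (1/suc-pos d)) (0≤h _)
    ... | false = ℚP.≤-refl

    moveFrom-nonNeg : ∀ d {h : Ω → ℚ} → (∀ S → 0ℚ ≤ h S) → 0ℚ ≤ moveFrom G h S v d
    moveFrom-nonNeg zero    0≤h = 0≤h S
    moveFrom-nonNeg (suc d) 0≤h = ΣL-nonNeg (allFin n) (edge-term-nonNeg d 0≤h)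

    moveFrom-≥-edge : ∀ d {h : Ω → ℚ} w → (∀ S → 0ℚ ≤ h S) → adj G v w ≡ true →
      1/suc d * h (S ∣ v ⇒ w) ≤ moveFrom G h S v (suc d)
    moveFrom-≥-edge d {h} w 0≤h v~w =
      subst (λ b → (if b then 1/suc d * h (S ∣ v ⇒ w) else 0ℚ) ≤ moveFrom G h S v (suc d)) v~w
        (term≤ΣL (allFin n) (edge-term-nonNeg d 0≤h) (∈-allFin w))

    moveFrom-const : ∀ d (c : ℚ) → d ≡ deg G v → moveFrom G (λ _ → c) S v d ≡ c
    moveFrom-const zero    c _      = refl
    moveFrom-const (suc d) c d≡deg = begin
      ΣL (allFin n) (λ w → if adj G v w then r * c else 0ℚ)
        ≡⟨ ΣL-cong (allFin n) (λ w → factor (adj G v w)) ⟩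
      ΣL (allFin n) (λ w → (r * c) * (if adj G v w then 1ℚ else 0ℚ))
        ≡⟨ ΣL-* (allFin n) (r * c) (λ w → if adj G v w then 1ℚ else 0ℚ) ⟩
      (r * c) * ΣL (allFin n) (λ w → if adj G v w then 1ℚ else 0ℚ)
        ≡⟨ cong ((r * c) *_) (trans (sym (deg≡ΣL v)) (cong ℕtoℚ (sym d≡deg))) ⟩
      (r * c) * ℕtoℚ (suc d)
        ≡⟨ solve 3 (λ r c m → (r :* c) :* m := (r :* m) :* c) refl r c (ℕtoℚ (suc d)) ⟩
      (r * ℕtoℚ (suc d)) * c  ≡⟨ cong (_* c) (1/suc-inverse d) ⟩
      1ℚ * c                  ≡⟨ ℚP.*-identityˡ c ⟩
      c                       ∎
      where
      open ≡-Reasoning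
      r = 1/suc d
      factor : ∀ b → (if b then r * c else 0ℚ) ≡ (r * c) * (if b then 1ℚ else 0ℚ)
      factor true  = sym (ℚP.*-identityʳ (r * c))
      factor false = sym (ℚP.*-zeroʳ (r * c))

    moveFrom-fixed : ∀ d {h : Ω → ℚ} → d ≡ deg G v → (∀ w → adj G v w ≡ true → h (S ∣ v ⇒ w) ≡ h S) →
                     moveFrom G h S v d ≡ h S
    moveFrom-fixed zero    _      _     = refl
    moveFrom-fixed (suc d) {h} d≡deg fixed = trans (ΣL-cong (allFin n) along-edge) (moveFrom-const (suc d) (h S) d≡deg)
      where
      along-edge : ∀ w → (if adj G v w then 1/suc d * h (S ∣ v ⇒ w) else 0ℚ)
                         ≡ (if adj G v w then 1/suc d * h S else 0ℚ)
      along-edge w with adj G v w in v~w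
      ... | true  = cong (1/suc d *_) (fixed w v~w)
      ... | false = refl

  step-cong : {h g : Ω → ℚ} → (∀ S → h S ≡ g S) → ∀ S → step h S ≡ step g S
  step-cong h≗g S = ΣL-cong (allFin n) λ v → cong (reproductionProb S v *_) (moveFrom-cong S v (deg G v) h≗g)

  step-linear : ∀ a (h g : Ω → ℚ) S → step (λ S → a * h S + g S) S ≡ a * step h S + step g S
  step-linear a h g S = begin
    ΣL (allFin n) (λ v → p v * moveFrom G (λ S → a * h S + g S) S v (deg G v))
      ≡⟨ ΣL-cong (allFin n) (λ v → trans (cong (p v *_) (moveFrom-linear S v (deg G v) a h g))
            (solve 4 (λ p a x y → p :* (a :* x :+ y) := a :* (p :* x) :+ p :* y) refl (p v) a (mh v) (mg v))) ⟩
    ΣL (allFin n) (λ v → a * (p v * mh v) + p v * mg v)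
      ≡⟨ ΣL-+ (allFin n) (λ v → a * (p v * mh v)) (λ v → p v * mg v) ⟩
    ΣL (allFin n) (λ v → a * (p v * mh v)) + step g S
      ≡⟨ cong (_+ step g S) (ΣL-* (allFin n) a (λ v → p v * mh v)) ⟩
    a * step h S + step g S ∎
    where
    open ≡-Reasoning
    p = reproductionProb S
    mh = λ v → moveFrom G h S v (deg G v)
    mg = λ v → moveFrom G g S v (deg G v)

  step-mono : {h g : Ω → ℚ} → (∀ S → h S ≤ g S) → ∀ S → step h S ≤ step g S
  step-mono h≤g S = ΣL-mono (allFin n) λ v →
    *-monoˡ-≤ (reproductionProb-nonNeg S v) (moveFrom-mono S v (deg G v) h≤g)

  step-nonNeg-term : {h : Ω → ℚ} → (∀ S → 0ℚ ≤ h S) → ∀ S v →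
                     0ℚ ≤ reproductionProb S v * moveFrom G h S v (deg G v)
  step-nonNeg-term 0≤h S v = *-nonNeg (reproductionProb-nonNeg S v) (moveFrom-nonNeg S v (deg G v) 0≤h)

  step-nonNeg : {h : Ω → ℚ} → (∀ S → 0ℚ ≤ h S) → ∀ S → 0ℚ ≤ step h S
  step-nonNeg 0≤h S = ΣL-nonNeg (allFin n) (step-nonNeg-term 0≤h S)

  step-const : ∀ (c : ℚ) S → step (λ _ → c) S ≡ c
  step-const c S = trans (ΣL-cong (allFin n) λ v → cong (reproductionProb S v *_) (moveFrom-const S v (deg G v) c refl))
                         (ΣL-reproductionProb-* c S)

  step-fixed : ∀ {h : Ω → ℚ} S → (∀ v w → adj G v w ≡ true → h (S ∣ v ⇒ w) ≡ h S) → step h S ≡ h S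
  step-fixed {h} S fixed =
    trans (ΣL-cong (allFin n) λ v → cong (reproductionProb S v *_) (moveFrom-fixed S v (deg G v) refl (fixed v)))
          (ΣL-reproductionProb-* (h S) S)

  step-≥-edge : ∀ {h : Ω → ℚ} S v w d → deg G v ≡ suc d → adj G v w ≡ true → (∀ S → 0ℚ ≤ h S) →
                reproductionProb S v * (1/suc d * h (S ∣ v ⇒ w)) ≤ step h S
  step-≥-edge {h} S v w d deg≡ v~w 0≤h = ℚP.≤-trans
    (*-monoˡ-≤ (reproductionProb-nonNeg S v)
      (subst (λ m → 1/suc d * h (S ∣ v ⇒ w) ≤ moveFrom G h S v m) (sym deg≡) (moveFrom-≥-edge S v d w 0≤h v~w)))
    (term≤ΣL (allFin n) (step-nonNeg-term 0≤h S) (∈-allFin v))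

  evolve-cong : {h g : Ω → ℚ} → (∀ S → h S ≡ g S) → ∀ t S → evolve t h S ≡ evolve t g S
  evolve-cong h≗g zero    S = h≗g S
  evolve-cong h≗g (suc t) S = step-cong (evolve-cong h≗g t) S

  evolve-linear : ∀ a (h g : Ω → ℚ) t S → evolve t (λ S → a * h S + g S) S ≡ a * evolve t h S + evolve t g S
  evolve-linear a h g zero    S = refl
  evolve-linear a h g (suc t) S = trans (step-cong (evolve-linear a h g t) S) (step-linear a (evolve t h) (evolve t g) S)

  evolve-mono : {h g : Ω → ℚ} → (∀ S → h S ≤ g S) → ∀ t S → evolve t h S ≤ evolve t g S
  evolve-mono h≤g zero    S = h≤g S
  evolve-mono h≤g (suc t) S = step-mono (evolve-mono h≤g t) S

  evolve-const : ∀ (c : ℚ) t S → evolve t (λ _ → c) S ≡ c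
  evolve-const c zero    S = refl
  evolve-const c (suc t) S = trans (step-cong (evolve-const c t) S) (step-const c S)

  evolve-nonNeg : {h : Ω → ℚ} → (∀ S → 0ℚ ≤ h S) → ∀ t S → 0ℚ ≤ evolve t h S
  evolve-nonNeg 0≤h zero    S = 0≤h S
  evolve-nonNeg 0≤h (suc t) S = step-nonNeg (evolve-nonNeg 0≤h t) S

  evolve-compose : ∀ a b (h : Ω → ℚ) S → evolve (a ℕ.+ b) h S ≡ evolve a (evolve b h) S
  evolve-compose zero    b h S = refl
  evolve-compose (suc a) b h S = step-cong (evolve-compose a b h) S

  evolve-* : ∀ a (h : Ω → ℚ) t S → evolve t (λ S → a * h S) S ≡ a * evolve t h S
  evolve-* a h t S = begin
    evolve t (λ S → a * h S) S                ≡⟨ evolve-cong (λ S → sym (ℚP.+-identityʳ (a * h S))) t S ⟩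
    evolve t (λ S → a * h S + 0ℚ) S           ≡⟨ evolve-linear a h (λ _ → 0ℚ) t S ⟩
    a * evolve t h S + evolve t (λ _ → 0ℚ) S  ≡⟨ cong (a * evolve t h S +_) (evolve-const 0ℚ t S) ⟩
    a * evolve t h S + 0ℚ                     ≡⟨ ℚP.+-identityʳ (a * evolve t h S) ⟩
    a * evolve t h S                          ∎
    where open ≡-Reasoning

  evolve-+ : ∀ (h g : Ω → ℚ) t S → evolve t (λ S → h S + g S) S ≡ evolve t h S + evolve t g S
  evolve-+ h g t S = begin
    evolve t (λ S → h S + g S) S         ≡⟨ evolve-cong (λ S → cong (_+ g S) (sym (ℚP.*-identityˡ (h S)))) t S ⟩
    evolve t (λ S → 1ℚ * h S + g S) S    ≡⟨ evolve-linear 1ℚ h g t S ⟩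
    1ℚ * evolve t h S + evolve t g S     ≡⟨ cong (_+ evolve t g S) (ℚP.*-identityˡ (evolve t h S)) ⟩
    evolve t h S + evolve t g S          ∎
    where open ≡-Reasoning

  evolve-fixed : ∀ S → (∀ v w → adj G v w ≡ true → S ∣ v ⇒ w ≡ S) → ∀ (h : Ω → ℚ) t → evolve t h S ≡ h S
  evolve-fixed S fixed h zero    = refl
  evolve-fixed S fixed h (suc t) =
    trans (step-fixed S (λ v w v~w → cong (evolve t h) (fixed v w v~w))) (evolve-fixed S fixed h t)

  fixProbBy-evolve : ∀ j t S → fixProbBy G f j t S ≡ evolve t (fixProbBy G f j 0) S
  fixProbBy-evolve j zero    S = refl
  fixProbBy-evolve j (suc t) S = step-cong (fixProbBy-evolve j t) S

-- The potential

module Potential {n′ k : ℕ} (G : Graph (suc n′)) (f : Fin k → ℚ) (1≤f : ∀ i → 1ℚ ≤ f i)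
                 (α : Fin k) (f≤fα : ∀ j → f j ≤ f α) where

  open MoranStep G f 1≤f

  -- The temperature 1/deg, written as moveFrom's coefficient so that the two agree definitionally.
  weight : ℕ → ℚ
  weight zero    = 1ℚ
  weight (suc d) = 1/suc d

  weight-pos : ∀ d → 0ℚ < weight d
  weight-pos zero    = ℚP.positive⁻¹ 1ℚ
  weight-pos (suc d) = 1/suc-pos d

  ω : Fin n → ℚ
  ω v = weight (deg G v)

  ω-nonNeg : ∀ v → 0ℚ ≤ ω v
  ω-nonNeg v = ℚP.<⇒≤ (weight-pos (deg G v))

  𝟙α : Fin k → ℚ
  𝟙α x = if does (x F.≟ α) then 1ℚ else 0ℚ

  potential : Ω → ℚ
  potential S = ΣL (allFin n) (λ u → 𝟙α (lookup S u) * ω u)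

  potential-move : ∀ S v w → potential (S ∣ v ⇒ w) ≡ potential S + (𝟙α (lookup S v) - 𝟙α (lookup S w)) * ω w
  potential-move S v w = begin
    φ′                                  ≡⟨ solve 2 (λ a b → a := (a :+ b) :- b) refl φ′ (eω w) ⟩
    (φ′ + eω w) - eω w                  ≡⟨ cong (_- eω w) (ΣL-[]≔ S w (lookup S v) (λ t u → 𝟙α t * ω u)) ⟩
    (potential S + 𝟙α (lookup S v) * ω w) - eω w
      ≡⟨ solve 4 (λ p a b c → (p :+ a :* c) :- b :* c := p :+ (a :- b) :* c) refl
                 (potential S) (𝟙α (lookup S v)) (𝟙α (lookup S w)) (ω w) ⟩
    potential S + (𝟙α (lookup S v) - 𝟙α (lookup S w)) * ω w ∎
    where
    open ≡-Reasoning
    φ′ = potential (S ∣ v ⇒ w)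
    eω = λ u → 𝟙α (lookup S u) * ω u

  gain : Ω → Fin n → ℚ
  gain S v = ΣL (allFin n) (λ w → if adj G v w then ω v * (potential (S ∣ v ⇒ w) - potential S) else 0ℚ)

  moveFrom-potential : ∀ d S v → d ≡ deg G v → moveFrom G potential S v d ≡ potential S + gain S v
  moveFrom-potential zero S v 0≡deg = sym (begin
    potential S + gain S v  ≡⟨ cong (potential S +_) (trans (ΣL-cong (allFin n) no-edge) (ΣL-zero (allFin n))) ⟩
    potential S + 0ℚ        ≡⟨ ℚP.+-identityʳ (potential S) ⟩
    potential S             ∎)
    where
    open ≡-Reasoning
    no-edge : ∀ w → (if adj G v w then ω v * (potential (S ∣ v ⇒ w) - potential S) else 0ℚ) ≡ 0ℚ
    no-edge w rewrite deg≡0⇒¬adj G v w (sym 0≡deg) = refl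
  moveFrom-potential (suc d) S v d≡deg = begin
    ΣL (allFin n) (λ w → if adj G v w then c * potential (S ∣ v ⇒ w) else 0ℚ)
      ≡⟨ ΣL-cong (allFin n) (λ w → split (adj G v w) w) ⟩
    ΣL (allFin n) (λ w → stay w + move w)
      ≡⟨ ΣL-+ (allFin n) stay move ⟩
    ΣL (allFin n) stay + ΣL (allFin n) move
      ≡⟨ cong₂ _+_ (moveFrom-const S v (suc d) (potential S) d≡deg)
                   (ΣL-cong (allFin n) (λ w → cong (λ r → if adj G v w then r * Δ w else 0ℚ) (cong weight d≡deg))) ⟩
    potential S + gain S v ∎
    where
    open ≡-Reasoning
    c = 1/suc d
    Δ = λ w → potential (S ∣ v ⇒ w) - potential S
    stay = λ w → if adj G v w then c * potential S else 0ℚ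
    move = λ w → if adj G v w then c * Δ w else 0ℚ
    split : ∀ b w → (if b then c * potential (S ∣ v ⇒ w) else 0ℚ)
                    ≡ (if b then c * potential S else 0ℚ) + (if b then c * Δ w else 0ℚ)
    split true  w = solve 3 (λ c x y → c :* x := c :* y :+ c :* (x :- y)) refl c (potential (S ∣ v ⇒ w)) (potential S)
    split false w = refl

  flux : Ω → Fin n → Fin n → ℚ
  flux S v w = (if adj G v w then ω v * ω w else 0ℚ) * f (lookup S v) * (𝟙α (lookup S v) - 𝟙α (lookup S w))

  fitness-𝟙α-comonotone : ∀ x y → 0ℚ ≤ (f x - f y) * (𝟙α x - 𝟙α y)
  fitness-𝟙α-comonotone x y with x F.≟ α | y F.≟ α
  ... | yes _   | yes _   = ℚP.≤-reflexive (sym (solve 1 (λ z → z :* (con 1ℚ :- con 1ℚ) := con 0ℚ) refl (f x - f y)))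
  ... | no _    | no _    = ℚP.≤-reflexive (sym (solve 1 (λ z → z :* (con 0ℚ :- con 0ℚ) := con 0ℚ) refl (f x - f y)))
  ... | yes x≡α | no _    = subst (0ℚ ≤_) (solve 1 (λ z → z := z :* (con 1ℚ :- con 0ℚ)) refl (f x - f y))
                              (≤⇒0≤- (subst (λ z → f y ≤ f z) (sym x≡α) (f≤fα y)))
  ... | no _    | yes y≡α = subst (0ℚ ≤_) (solve 2 (λ a b → b :- a := (a :- b) :* (con 0ℚ :- con 1ℚ)) refl (f x) (f y))
                              (≤⇒0≤- (subst (λ z → f x ≤ f z) (sym y≡α) (f≤fα x)))

  flux-+-flip-nonNeg : ∀ S v w → 0ℚ ≤ flux S v w + flux S w v
  flux-+-flip-nonNeg S v w = subst (0ℚ ≤_) (sym flux-+-flip)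
    (*-nonNeg edge-nonNeg (fitness-𝟙α-comonotone (lookup S v) (lookup S w)))
    where
    a = if adj G v w then ω v * ω w else 0ℚ
    edge-nonNeg : 0ℚ ≤ a
    edge-nonNeg with adj G v w
    ... | true  = *-nonNeg (ω-nonNeg v) (ω-nonNeg w)
    ... | false = ℚP.≤-refl
    a-sym : (if adj G w v then ω w * ω v else 0ℚ) ≡ a
    a-sym rewrite adj-sym G w v = cong (λ z → if adj G v w then z else 0ℚ) (ℚP.*-comm (ω w) (ω v))
    flux-+-flip : flux S v w + flux S w v ≡ a * ((f (lookup S v) - f (lookup S w)) * (𝟙α (lookup S v) - 𝟙α (lookup S w)))
    flux-+-flip rewrite a-sym =
      solve 5 (λ a fv fw ev ew → a :* fv :* (ev :- ew) :+ a :* fw :* (ew :- ev) := a :* ((fv :- fw) :* (ev :- ew)))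
        refl a (f (lookup S v)) (f (lookup S w)) (𝟙α (lookup S v)) (𝟙α (lookup S w))

  totalFlux : Ω → ℚ
  totalFlux S = ΣL (allFin n) (λ v → ΣL (allFin n) (flux S v))

  -- Summing flux over all ordered pairs counts each edge in both directions.
  totalFlux-nonNeg : ∀ S → 0ℚ ≤ totalFlux S
  totalFlux-nonNeg S = 0≤+⇒0≤ (subst (0ℚ ≤_) (sym twice)
    (ΣL-nonNeg (allFin n) λ v → ΣL-nonNeg (allFin n) λ w → flux-+-flip-nonNeg S v w))
    where
    open ≡-Reasoning
    twice : totalFlux S + totalFlux S ≡ ΣL (allFin n) (λ v → ΣL (allFin n) (λ w → flux S v w + flux S w v))
    twice = begin
      totalFlux S + totalFlux S
        ≡⟨ cong (totalFlux S +_) (ΣL-swap (allFin n) (allFin n) (flux S)) ⟩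
      totalFlux S + ΣL (allFin n) (λ v → ΣL (allFin n) (λ w → flux S w v))
        ≡⟨ sym (ΣL-+ (allFin n) (λ v → ΣL (allFin n) (flux S v)) (λ v → ΣL (allFin n) (λ w → flux S w v))) ⟩
      ΣL (allFin n) (λ v → ΣL (allFin n) (flux S v) + ΣL (allFin n) (λ w → flux S w v))
        ≡⟨ ΣL-cong (allFin n) (λ v → sym (ΣL-+ (allFin n) (flux S v) (λ w → flux S w v))) ⟩
      ΣL (allFin n) (λ v → ΣL (allFin n) (λ w → flux S v w + flux S w v)) ∎

  reproductionProb-*-gain : ∀ S v → reproductionProb S v * gain S v ≡ divQ 1ℚ (totalFitness f S) * ΣL (allFin n) (flux S v)
  reproductionProb-*-gain S v = begin
    p * gain S v
      ≡⟨ sym (ΣL-* (allFin n) p (λ w → if adj G v w then ω v * (potential (S ∣ v ⇒ w) - potential S) else 0ℚ)) ⟩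
    ΣL (allFin n) (λ w → p * (if adj G v w then ω v * (potential (S ∣ v ⇒ w) - potential S) else 0ℚ))
      ≡⟨ ΣL-cong (allFin n) (λ w → along-edge w (adj G v w)) ⟩
    ΣL (allFin n) (λ w → 1/T * flux S v w)
      ≡⟨ ΣL-* (allFin n) 1/T (flux S v) ⟩
    1/T * ΣL (allFin n) (flux S v) ∎
    where
    open ≡-Reasoning
    p = reproductionProb S v
    1/T = divQ 1ℚ (totalFitness f S)
    fv = f (lookup S v)
    Δ𝟙 = λ w → 𝟙α (lookup S v) - 𝟙α (lookup S w)
    p≡ : p ≡ fv * 1/T
    p≡ = divQ≡*divQ1 fv (totalFitness-pos S)
    Δpotential : ∀ w → potential (S ∣ v ⇒ w) - potential S ≡ Δ𝟙 w * ω w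
    Δpotential w = trans (cong (_- potential S) (potential-move S v w))
                         (solve 2 (λ p d → (p :+ d) :- p := d) refl (potential S) (Δ𝟙 w * ω w))
    along-edge : ∀ w b → p * (if b then ω v * (potential (S ∣ v ⇒ w) - potential S) else 0ℚ)
                         ≡ 1/T * ((if b then ω v * ω w else 0ℚ) * fv * Δ𝟙 w)
    along-edge w true  = trans (cong₂ (λ a b → a * (ω v * b)) p≡ (Δpotential w))
      (solve 5 (λ fv t ov ow d → (fv :* t) :* (ov :* (d :* ow)) := t :* (ov :* ow :* fv :* d)) refl fv 1/T (ω v) (ω w) (Δ𝟙 w))
    along-edge w false = solve 4 (λ p t fv d → p :* con 0ℚ := t :* (con 0ℚ :* fv :* d)) refl p 1/T fv (Δ𝟙 w)

  step-potential : ∀ S → step potential S ≡ potential S + divQ 1ℚ (totalFitness f S) * totalFlux S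
  step-potential S = begin
    step potential S
      ≡⟨ ΣL-cong (allFin n) (λ v → cong (p v *_) (moveFrom-potential (deg G v) S v refl)) ⟩
    ΣL (allFin n) (λ v → p v * (potential S + gain S v))
      ≡⟨ ΣL-cong (allFin n) (λ v → ℚP.*-distribˡ-+ (p v) (potential S) (gain S v)) ⟩
    ΣL (allFin n) (λ v → p v * potential S + p v * gain S v)
      ≡⟨ ΣL-+ (allFin n) (λ v → p v * potential S) (λ v → p v * gain S v) ⟩
    ΣL (allFin n) (λ v → p v * potential S) + ΣL (allFin n) (λ v → p v * gain S v)
      ≡⟨ cong₂ _+_ (ΣL-reproductionProb-* (potential S) S)
                   (trans (ΣL-cong (allFin n) (reproductionProb-*-gain S))
                          (ΣL-* (allFin n) 1/T (λ v → ΣL (allFin n) (flux S v)))) ⟩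
    potential S + 1/T * totalFlux S ∎
    where
    open ≡-Reasoning
    p = reproductionProb S
    1/T = divQ 1ℚ (totalFitness f S)

  potential≤step : ∀ S → potential S ≤ step potential S
  potential≤step S = subst (potential S ≤_) (sym (step-potential S))
    (subst (_≤ potential S + drift) (ℚP.+-identityʳ (potential S))
      (ℚP.+-monoʳ-≤ (potential S) (*-nonNeg (ℚP.<⇒≤ (divQ1-pos (totalFitness-pos S))) (totalFlux-nonNeg S))))
    where drift = divQ 1ℚ (totalFitness f S) * totalFlux S

  potential≤evolve : ∀ t S → potential S ≤ evolve t potential S
  potential≤evolve zero    S = ℚP.≤-refl
  potential≤evolve (suc t) S = ℚP.≤-trans (potential≤step S) (step-mono (potential≤evolve t) S)

-- Absorption

module Absorption {n′ k : ℕ} (G : Graph (suc n′)) (connected : Connected G)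
                  (f : Fin k → ℚ) (1≤f : ∀ i → 1ℚ ≤ f i) (α : Fin k) (f≤fα : ∀ j → f j ≤ f α) where

  open MoranStep G f 1≤f

  fixated : Fin k → Ω → ℚ
  fixated c S = if allEq c S then 1ℚ else 0ℚ

  unfixated : Ω → ℚ
  unfixated S = if allEq (lookup S zero) S then 0ℚ else 1ℚ

  private
    nQ = ℕtoℚ n
    1≤nQ : 1ℚ ≤ nQ
    1≤nQ = ℕtoℚ-mono-≤ {1} {n} (ℕ.s≤s ℕ.z≤n)
    1≤Fn : 1ℚ ≤ f α * nQ
    1≤Fn = ℚP.≤-trans (ℚP.≤-reflexive (sym (ℚP.*-identityˡ 1ℚ)))
                      (*-mono-≤ 0≤1 (ℚP.≤-trans 0≤1 1≤nQ) (1≤f α) 1≤nQ)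

  -- Bounds from below the probability that a given vertex reproduces onto a given neighbour.
  q : ℚ
  q = divQ 1ℚ (f α * nQ) * divQ 1ℚ nQ

  q-pos : 0ℚ < q
  q-pos = *-pos (divQ1-pos (ℚP.<-≤-trans (ℚP.positive⁻¹ 1ℚ) 1≤Fn)) (divQ1-pos (ℚP.<-≤-trans (ℚP.positive⁻¹ 1ℚ) 1≤nQ))

  q≤1 : q ≤ 1ℚ
  q≤1 = ℚP.≤-trans (*-mono-≤ (ℚP.<⇒≤ (divQ1-pos 0<Fn)) 0≤1 (divQ1-antimono (ℚP.positive⁻¹ 1ℚ) 1≤Fn)
                                                           (divQ1-antimono (ℚP.positive⁻¹ 1ℚ) 1≤nQ))
                   (ℚP.≤-reflexive (ℚP.*-identityˡ 1ℚ))
    where 0<Fn = ℚP.<-≤-trans (ℚP.positive⁻¹ 1ℚ) 1≤Fn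

  q≤edgeProb : ∀ S v d → deg G v ≡ suc d → q ≤ reproductionProb S v * 1/suc d
  q≤edgeProb S v d deg≡ = *-mono-≤ (ℚP.<⇒≤ (divQ1-pos (ℚP.<-≤-trans (ℚP.positive⁻¹ 1ℚ) 1≤Fn)))
                                   (ℚP.<⇒≤ (1/suc-pos d)) 1/Fn≤p 1/n≤1/deg
    where
    T = totalFitness f S
    T≤Fn : T ≤ f α * nQ
    T≤Fn = ℚP.≤-trans (ΣL-mono (allFin n) (λ u → f≤fα (lookup S u)))
                      (ℚP.≤-reflexive (trans (ΣL-const (allFin n) (f α)) (cong (λ m → f α * ℕtoℚ m) (LP.length-tabulate {n = n} (λ i → i)))))
    1/Fn≤p : divQ 1ℚ (f α * nQ) ≤ reproductionProb S v
    1/Fn≤p = begin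
      divQ 1ℚ (f α * nQ)           ≤⟨ divQ1-antimono (totalFitness-pos S) T≤Fn ⟩
      divQ 1ℚ T                  ≡⟨ sym (ℚP.*-identityˡ (divQ 1ℚ T)) ⟩
      1ℚ * divQ 1ℚ T             ≤⟨ *-monoʳ-≤ (ℚP.<⇒≤ (divQ1-pos (totalFitness-pos S))) (1≤f (lookup S v)) ⟩
      f (lookup S v) * divQ 1ℚ T ≡⟨ sym (divQ≡*divQ1 (f (lookup S v)) (totalFitness-pos S)) ⟩
      reproductionProb S v       ∎
      where open ℚP.≤-Reasoning
    1/n≤1/deg : divQ 1ℚ nQ ≤ 1/suc d
    1/n≤1/deg = subst (divQ 1ℚ nQ ≤_) (sym (1/suc≡divQ1 d))
      (divQ1-antimono (ℕtoℚ-suc-pos d) (ℕtoℚ-mono-≤ (subst (ℕ._≤ n) deg≡ (deg≤n G v))))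

  fixated-nonNeg : ∀ c S → 0ℚ ≤ fixated c S
  fixated-nonNeg c S with allEq c S
  ... | true  = 0≤1
  ... | false = ℚP.≤-refl

  -- Repeatedly let a vertex of type c on the boundary of the c-region reproduce outwards.
  q^t≤fixation : ∀ c t S → lookup S zero ≡ c → mismatches c S ℕ.≤ t → q ^ t ≤ evolve t (fixated c) S
  q^t≤fixation c zero S S₀≡c mis≤0
    rewrite lookup⇒allEq c S (mismatches≡0 c S (ℕP.n≤0⇒n≡0 mis≤0)) = ℚP.≤-refl
  q^t≤fixation c (suc t) S S₀≡c mis≤t with monochromatic? c S
  ... | inj₁ S≡c rewrite evolve-fixed S (λ v w _ → monochromatic-move c S S≡c v w) (fixated c) (suc t)
                       | lookup⇒allEq c S S≡c = ^-≤1 (ℚP.<⇒≤ q-pos) q≤1 (suc t)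
  ... | inj₂ (u , Su≢c) with walk-boundary-edge (connected zero u) S c S₀≡c Su≢c
  ...   | v , w , v~w , Sv≡c , Sw≢c with ℕP.m≤n⇒∃[o]m+o≡n (adj⇒1≤deg G v w v~w)
  ...     | d , 1+d≡deg = ℚP.≤-trans spread (step-≥-edge S v w d (sym 1+d≡deg) v~w (evolve-nonNeg (fixated-nonNeg c) t))
    where
    S′ = S ∣ v ⇒ w
    S′≡ : S′ ≡ S [ w ]≔ c
    S′≡ = cong (S [ w ]≔_) Sv≡c
    ih : q ^ t ≤ evolve t (fixated c) S′
    ih = subst (λ X → q ^ t ≤ evolve t (fixated c) X) (sym S′≡)
           (q^t≤fixation c t (S [ w ]≔ c) (lookup-[]≔-same c S zero w S₀≡c)
             (ℕ.s≤s⁻¹ (subst (ℕ._≤ suc t) (sym (mismatches-[]≔ c S w Sw≢c)) mis≤t)))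
    spread : q ^ suc t ≤ reproductionProb S v * (1/suc d * evolve t (fixated c) S′)
    spread = ℚP.≤-trans (*-mono-≤ (ℚP.<⇒≤ q-pos) (evolve-nonNeg (fixated-nonNeg c) t S′) (q≤edgeProb S v d (sym 1+d≡deg)) ih)
                        (ℚP.≤-reflexive (ℚP.*-assoc (reproductionProb S v) _ _))

  unfixated+fixated≤1 : ∀ c S → unfixated S + fixated c S ≤ 1ℚ
  unfixated+fixated≤1 c S with allEq c S in S≡c
  ... | true  = ℚP.≤-reflexive (cong (λ b → (if b then 0ℚ else 1ℚ) + 1ℚ)
                 (trans (cong (λ x → allEq x S) (allEq⇒lookup c S S≡c zero)) S≡c))
  ... | false = ℚP.≤-trans (ℚP.≤-reflexive (ℚP.+-identityʳ (unfixated S))) unfixated≤1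
    where
    unfixated≤1 : unfixated S ≤ 1ℚ
    unfixated≤1 with allEq (lookup S zero) S
    ... | true  = 0≤1
    ... | false = ℚP.≤-refl

  -- Bounds from above the probability of remaining unfixated for n steps.
  B : ℚ
  B = 1ℚ - q ^ n

  B-nonNeg : 0ℚ ≤ B
  B-nonNeg = ≤⇒0≤- (^-≤1 (ℚP.<⇒≤ q-pos) q≤1 n)

  evolve-unfixated : ∀ S → evolve n unfixated S ≤ B * unfixated S
  evolve-unfixated S with allEq (lookup S zero) S in S≡S₀
  ... | true  = ℚP.≤-reflexive (trans (evolve-fixed S (λ v w _ → monochromatic-move (lookup S zero) S
                                                   (allEq⇒lookup (lookup S zero) S S≡S₀) v w) unfixated n)
                                      (trans (cong (λ b → if b then 0ℚ else 1ℚ) S≡S₀) (sym (ℚP.*-zeroʳ B))))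
  ... | false = ℚP.≤-trans stays (ℚP.≤-reflexive (sym (ℚP.*-identityʳ B)))
    where
    c = lookup S zero
    total≤1 : evolve n unfixated S + evolve n (fixated c) S ≤ 1ℚ
    total≤1 = begin
      evolve n unfixated S + evolve n (fixated c) S  ≡⟨ sym (evolve-+ unfixated (fixated c) n S) ⟩
      evolve n (λ S → unfixated S + fixated c S) S   ≤⟨ evolve-mono (unfixated+fixated≤1 c) n S ⟩
      evolve n (λ _ → 1ℚ) S                          ≡⟨ evolve-const 1ℚ n S ⟩
      1ℚ                                             ∎
      where open ℚP.≤-Reasoning
    stays : evolve n unfixated S ≤ B
    stays = begin
      N                                                 ≡⟨ solve 2 (λ x p → x := x :+ p :- p) refl N (q ^ n) ⟩
      N + q ^ n - q ^ n                                 ≤⟨ ℚP.+-monoˡ-≤ (- q ^ n) (ℚP.+-monoʳ-≤ N spreads) ⟩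
      N + evolve n (fixated c) S - q ^ n                ≤⟨ ℚP.+-monoˡ-≤ (- q ^ n) total≤1 ⟩
      B                                                 ∎
      where
      open ℚP.≤-Reasoning
      N = evolve n unfixated S
      spreads = q^t≤fixation c n S refl (mismatches≤length c S)

  unfixated-decay : ∀ m S → evolve (m ℕ.* n) unfixated S ≤ B ^ m
  unfixated-decay zero    S with allEq (lookup S zero) S
  ... | true  = 0≤1
  ... | false = ℚP.≤-refl
  unfixated-decay (suc m) S = begin
    evolve (n ℕ.+ m ℕ.* n) unfixated S         ≡⟨ cong (λ t → evolve t unfixated S) (ℕP.+-comm n (m ℕ.* n)) ⟩
    evolve (m ℕ.* n ℕ.+ n) unfixated S         ≡⟨ evolve-compose (m ℕ.* n) n unfixated S ⟩
    evolve (m ℕ.* n) (evolve n unfixated) S    ≤⟨ evolve-mono evolve-unfixated (m ℕ.* n) S ⟩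
    evolve (m ℕ.* n) (λ S → B * unfixated S) S ≡⟨ evolve-* B unfixated (m ℕ.* n) S ⟩
    B * evolve (m ℕ.* n) unfixated S           ≤⟨ *-monoˡ-≤ B-nonNeg (unfixated-decay m S) ⟩
    B * B ^ m                                  ∎
    where open ℚP.≤-Reasoning

notIn⇒lookup≢ : ∀ {r m} (x : Fin r) (xs : Vec (Fin r) m) → notIn x (toList xs) ≡ true → ∀ j → lookup xs j ≢ x
notIn⇒lookup≢ x (y ∷ xs) x∉ j y≡x with x F.≟ y
notIn⇒lookup≢ x (y ∷ xs) () j       y≡x | yes _
notIn⇒lookup≢ x (y ∷ xs) x∉ zero    y≡x | no x≢y = x≢y (sym y≡x)
notIn⇒lookup≢ x (y ∷ xs) x∉ (suc j) xs≡x | no _  = notIn⇒lookup≢ x xs x∉ j xs≡x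

distinct⇒lookup-injective : ∀ {r m} (γ : Vec (Fin r) m) → distinct γ ≡ true →
                            ∀ i j → lookup γ i ≡ lookup γ j → i ≡ j
distinct⇒lookup-injective (x ∷ γ) dγ i j e with notIn x (toList γ) in x∉γ
distinct⇒lookup-injective (x ∷ γ) ()  i       j       e | false
distinct⇒lookup-injective (x ∷ γ) dγ  zero    zero    e | true = refl
distinct⇒lookup-injective (x ∷ γ) dγ  zero    (suc j) e | true = ⊥-elim (notIn⇒lookup≢ x γ x∉γ j (sym e))
distinct⇒lookup-injective (x ∷ γ) dγ  (suc i) zero    e | true = ⊥-elim (notIn⇒lookup≢ x γ x∉γ i e)
distinct⇒lookup-injective (x ∷ γ) dγ  (suc i) (suc j) e | true = cong suc (distinct⇒lookup-injective γ dγ i j e)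

∈-lookup? : ∀ {r m} (a : Fin r) (γ : Vec (Fin r) m) → (∃ λ i → lookup γ i ≡ a) ⊎ (∀ i → lookup γ i ≢ a)
∈-lookup? a []      = inj₂ (λ ())
∈-lookup? a (x ∷ γ) with x F.≟ a | ∈-lookup? a γ
... | yes x≡a | _             = inj₁ (zero , x≡a)
... | no _    | inj₁ (i , γi≡a) = inj₁ (suc i , γi≡a)
... | no x≢a  | inj₂ γ≢a      = inj₂ λ { zero → x≢a ; (suc i) → γ≢a i }

distinct-surjective : ∀ {k} (γ : Vec (Fin k) k) → distinct γ ≡ true → ∀ a → ∃ λ i → lookup γ i ≡ a
distinct-surjective {zero}  γ _  ()
distinct-surjective {suc k} γ dγ a with ∈-lookup? a γ
... | inj₁ found = found
... | inj₂ γ≢a with FP.pigeonhole (ℕP.n<1+n k) (λ i → F.punchOut {i = a} (λ a≡γi → γ≢a i (sym a≡γi)))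
...   | i , j , i<j , same = ⊥-elim (FP.<⇒≢ i<j (distinct⇒lookup-injective γ dγ i j
          (FP.punchOut-injective (λ e → γ≢a i (sym e)) (λ e → γ≢a j (sym e)) same)))

module _ {n : ℕ} (π : Permutation′ n) where

  private
    πʳ = π ⟨$⟩ʳ_

  ⟨$⟩ʳ-injective : ∀ {x y} → πʳ x ≡ πʳ y → x ≡ y
  ⟨$⟩ʳ-injective {x} {y} πx≡πy = trans (sym (Perm.inverseˡ π)) (trans (cong (π ⟨$⟩ˡ_) πx≡πy) (Perm.inverseˡ π))

  does-≟-⟨$⟩ʳ : ∀ x y → does (πʳ x F.≟ πʳ y) ≡ does (x F.≟ y)
  does-≟-⟨$⟩ʳ x y with x F.≟ y
  ... | yes refl = dec-true (πʳ x F.≟ πʳ x) refl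
  ... | no x≢y   = dec-false (πʳ x F.≟ πʳ y) (λ e → x≢y (⟨$⟩ʳ-injective e))

  notIn-map : ∀ x (ys : List (Fin n)) → notIn (πʳ x) (map πʳ ys) ≡ notIn x ys
  notIn-map x []       = refl
  notIn-map x (y ∷ ys) rewrite does-≟-⟨$⟩ʳ x y | notIn-map x ys = refl

  distinctL-map : (xs : List (Fin n)) → distinctL (map πʳ xs) ≡ distinctL xs
  distinctL-map []       = refl
  distinctL-map (x ∷ xs) rewrite notIn-map x xs | distinctL-map xs = refl

  distinct-map : ∀ {m} (u : Vec (Fin n) m) → distinct (V.map πʳ u) ≡ distinct u
  distinct-map u = trans (cong distinctL (VP.toList-map πʳ u)) (distinctL-map (toList u))

  ΣL-allStates-permute : ∀ m (g : Vec (Fin n) m → ℚ) → ΣL (allStates m n) (λ u → g (V.map πʳ u)) ≡ ΣL (allStates m n) g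
  ΣL-allStates-permute zero    g = refl
  ΣL-allStates-permute (suc m) g = begin
    ΣL (allStates (suc m) n) (λ u → g (V.map πʳ u))
      ≡⟨ ΣL-concatMap (λ x → map (x ∷_) (allStates m n)) (allFin n) (λ u → g (V.map πʳ u)) ⟩
    ΣL (allFin n) (λ x → ΣL (map (x ∷_) (allStates m n)) (λ u → g (V.map πʳ u)))
      ≡⟨ ΣL-cong (allFin n) (λ x → trans (ΣL-map (x ∷_) (allStates m n) (λ u → g (V.map πʳ u)))
                                         (ΣL-allStates-permute m (λ r → g (πʳ x ∷ r)))) ⟩
    ΣL (allFin n) (λ x → ΣL (allStates m n) (λ r → g (πʳ x ∷ r)))
      ≡⟨ ΣL-allFin-permute π (λ x → ΣL (allStates m n) (λ r → g (x ∷ r))) ⟩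
    ΣL (allFin n) (λ x → ΣL (allStates m n) (λ r → g (x ∷ r)))
      ≡⟨ sym (ΣL-cong (allFin n) (λ x → ΣL-map (x ∷_) (allStates m n) g)) ⟩
    ΣL (allFin n) (λ x → ΣL (map (x ∷_) (allStates m n)) g)
      ≡⟨ sym (ΣL-concatMap (λ x → map (x ∷_) (allStates m n)) (allFin n) g) ⟩
    ΣL (allStates (suc m) n) g ∎
    where open ≡-Reasoning

transpose-source : ∀ {n} (a b : Fin n) → Perm.transpose a b ⟨$⟩ʳ a ≡ b
transpose-source a b rewrite dec-true (a F.≟ a) refl = refl

distinctTuples : (m r : ℕ) → List (Vec (Fin r) m)
distinctTuples m r = filterᵇ distinct (allTuples m r)

module _ {n′ k : ℕ} (i : Fin k) where

  private
    n = suc n′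

  private
    through : Fin n → Vec (Fin n) k → ℚ
    through v u = if distinct u then (if does (v F.≟ lookup u i) then 1ℚ else 0ℚ) else 0ℚ

  countThrough : Fin n → ℚ
  countThrough v = ΣL (allTuples k n) (through v)

  -- Transposing v and v′ is a bijection on distinct tuples exchanging those through v and through v′.
  countThrough-const : ∀ v v′ → countThrough v′ ≡ countThrough v
  countThrough-const v v′ = begin
    countThrough v′                                         ≡⟨ sym (ΣL-allStates-permute π k (through v′)) ⟩
    ΣL (allTuples k n) (λ u → through v′ (V.map (π ⟨$⟩ʳ_) u)) ≡⟨ ΣL-cong (allTuples k n) moved ⟩
    countThrough v                                          ∎
    where
    open ≡-Reasoning
    π = Perm.transpose v v′
    moved : ∀ u → through v′ (V.map (π ⟨$⟩ʳ_) u) ≡ through v u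
    moved u = cong₂ (λ b c → if b then (if c then 1ℚ else 0ℚ) else 0ℚ) (distinct-map π u)
      (trans (cong (λ z → does (v′ F.≟ z)) (VP.lookup-map i (π ⟨$⟩ʳ_) u))
        (trans (cong (λ z → does (z F.≟ π ⟨$⟩ʳ lookup u i)) (sym (transpose-source v v′))) (does-≟-⟨$⟩ʳ π v (lookup u i))))

  ΣL-countThrough : ΣL (allFin n) countThrough ≡ ℕtoℚ (length (distinctTuples k n))
  ΣL-countThrough = begin
    ΣL (allFin n) countThrough
      ≡⟨ ΣL-swap (allFin n) (allTuples k n) through ⟩
    ΣL (allTuples k n) (λ u → ΣL (allFin n) (λ v → through v u))
      ≡⟨ ΣL-cong (allTuples k n) one-vertex ⟩
    ΣL (allTuples k n) (λ u → if distinct u then 1ℚ else 0ℚ)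
      ≡⟨ sym (ΣL-filterᵇ distinct (allTuples k n) (λ _ → 1ℚ)) ⟩
    ΣL (distinctTuples k n) (λ _ → 1ℚ)
      ≡⟨ ΣL-1 (distinctTuples k n) ⟩
    ℕtoℚ (length (distinctTuples k n)) ∎
    where
    open ≡-Reasoning
    one-vertex : ∀ u → ΣL (allFin n) (λ v → through v u)
                       ≡ (if distinct u then 1ℚ else 0ℚ)
    one-vertex u with distinct u
    ... | true  = ΣL-indicator n (lookup u i) 1ℚ
    ... | false = ΣL-zero (allFin n)

  ΣL-distinctTuples-lookup : ∀ (ω : Fin n → ℚ) →
    ΣL (distinctTuples k n) (λ u → ω (lookup u i)) * ℕtoℚ n ≡ ℕtoℚ (length (distinctTuples k n)) * ΣL (allFin n) ω
  ΣL-distinctTuples-lookup ω = begin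
    ΣL (distinctTuples k n) (λ u → ω (lookup u i)) * ℕtoℚ n
      ≡⟨ cong (_* ℕtoℚ n) (trans (ΣL-filterᵇ distinct (allTuples k n) (λ u → ω (lookup u i)))
                                  (ΣL-cong (allTuples k n) by-vertex)) ⟩
    ΣL (allTuples k n) (λ u → ΣL (allFin n) (λ v → ω v * through v u)) * ℕtoℚ n
      ≡⟨ cong (_* ℕtoℚ n) (ΣL-swap (allTuples k n) (allFin n) (λ u v → ω v * through v u)) ⟩
    ΣL (allFin n) (λ v → ΣL (allTuples k n) (λ u → ω v * through v u)) * ℕtoℚ n
      ≡⟨ cong (_* ℕtoℚ n) (ΣL-cong (allFin n) λ v → trans (ΣL-* (allTuples k n) (ω v) (through v))
                                                    (trans (cong (ω v *_) (countThrough-const zero v)) (ℚP.*-comm (ω v) c₀))) ⟩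
    ΣL (allFin n) (λ v → c₀ * ω v) * ℕtoℚ n
      ≡⟨ cong (_* ℕtoℚ n) (ΣL-* (allFin n) c₀ ω) ⟩
    c₀ * ΣL (allFin n) ω * ℕtoℚ n
      ≡⟨ solve 3 (λ c w m → c :* w :* m := (c :* m) :* w) refl c₀ (ΣL (allFin n) ω) (ℕtoℚ n) ⟩
    (c₀ * ℕtoℚ n) * ΣL (allFin n) ω
      ≡⟨ cong (_* ΣL (allFin n) ω) c₀*n ⟩
    ℕtoℚ (length (distinctTuples k n)) * ΣL (allFin n) ω ∎
    where
    open ≡-Reasoning
    c₀ = countThrough zero
    c₀*n : c₀ * ℕtoℚ n ≡ ℕtoℚ (length (distinctTuples k n))
    c₀*n = begin
      c₀ * ℕtoℚ n                       ≡⟨ cong (λ m → c₀ * ℕtoℚ m) (sym (LP.length-tabulate {n = n} (λ v → v))) ⟩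
      c₀ * ℕtoℚ (length (allFin n))     ≡⟨ sym (ΣL-const (allFin n) c₀) ⟩
      ΣL (allFin n) (λ _ → c₀)          ≡⟨ ΣL-cong (allFin n) (λ v → countThrough-const v zero) ⟩
      ΣL (allFin n) countThrough        ≡⟨ ΣL-countThrough ⟩
      ℕtoℚ (length (distinctTuples k n)) ∎
    pick : ∀ v z → (if does (v F.≟ z) then ω z else 0ℚ) ≡ ω v * (if does (v F.≟ z) then 1ℚ else 0ℚ)
    pick v z with v F.≟ z
    ... | yes refl = sym (ℚP.*-identityʳ (ω v))
    ... | no _     = sym (ℚP.*-zeroʳ (ω v))
    by-vertex : ∀ u → (if distinct u then ω (lookup u i) else 0ℚ) ≡ ΣL (allFin n) (λ v → ω v * through v u)
    by-vertex u with distinct u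
    ... | true  = trans (sym (ΣL-indicator n (lookup u i) (ω (lookup u i)))) (ΣL-cong (allFin n) (λ v → pick v (lookup u i)))
    ... | false = sym (trans (ΣL-cong (allFin n) (λ v → ℚP.*-zeroʳ (ω v))) (ΣL-zero (allFin n)))

-- Initial distributions

ΣL-filterᵇ-mono : ∀ {A : Set} (p : A → Bool) (xs : List A) {g h : A → ℚ} →
                  (∀ x → p x ≡ true → g x ≤ h x) → ΣL (filterᵇ p xs) g ≤ ΣL (filterᵇ p xs) h
ΣL-filterᵇ-mono p []       g≤h = ℚP.≤-refl
ΣL-filterᵇ-mono p (x ∷ xs) g≤h with p x in px
... | true  = ℚP.+-mono-≤ (g≤h x px) (ΣL-filterᵇ-mono p xs g≤h)
... | false = ΣL-filterᵇ-mono p xs g≤h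

module _ {n k : ℕ} where

  expect : (State n k → ℚ) → (State n k → ℚ) → ℚ
  expect D h = ΣL (allStates n k) (λ S → D S * h S)

  expect-mono : ∀ {D h g} → (∀ S → 0ℚ ≤ D S) → (∀ S → h S ≤ g S) → expect D h ≤ expect D g
  expect-mono 0≤D h≤g = ΣL-mono (allStates n k) (λ S → *-monoˡ-≤ (0≤D S) (h≤g S))

  expect-affine : ∀ {D} → IsDist D → ∀ a (h : State n k → ℚ) c →
                  expect D (λ S → a * (h S + c)) ≡ a * (expect D h + c)
  expect-affine {D} (_ , ΣD≡1) a h c = begin
    ΣL Ω (λ S → D S * (a * (h S + c)))
      ≡⟨ ΣL-cong Ω (λ S → solve 4 (λ d a h c → d :* (a :* (h :+ c)) := a :* (d :* h) :+ (a :* c) :* d) refl (D S) a (h S) c) ⟩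
    ΣL Ω (λ S → a * (D S * h S) + (a * c) * D S)
      ≡⟨ ΣL-+ Ω (λ S → a * (D S * h S)) (λ S → (a * c) * D S) ⟩
    ΣL Ω (λ S → a * (D S * h S)) + ΣL Ω (λ S → (a * c) * D S)
      ≡⟨ cong₂ _+_ (ΣL-* Ω a (λ S → D S * h S)) (trans (ΣL-* Ω (a * c) D) (cong ((a * c) *_) ΣD≡1)) ⟩
    a * expect D h + (a * c) * 1ℚ
      ≡⟨ solve 3 (λ a e c → a :* e :+ (a :* c) :* con 1ℚ := a :* (e :+ c)) refl a (expect D h) c ⟩
    a * (expect D h + c) ∎
    where
    open ≡-Reasoning
    Ω = allStates n k

  ≤-expect : ∀ {D h c} → IsDist D → (∀ S → 0ℚ < D S → c ≤ h S) → c ≤ expect D h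
  ≤-expect {D} {h} {c} (0≤D , ΣD≡1) c≤h = begin
    c                              ≡⟨ sym (trans (cong (c *_) ΣD≡1) (ℚP.*-identityʳ c)) ⟩
    c * ΣL (allStates n k) D       ≡⟨ sym (ΣL-* (allStates n k) c D) ⟩
    ΣL (allStates n k) (λ S → c * D S) ≤⟨ ΣL-mono (allStates n k) on-support ⟩
    expect D h                     ∎
    where
    open ℚP.≤-Reasoning
    on-support : ∀ S → c * D S ≤ D S * h S
    on-support S with ℚP.<-cmp 0ℚ (D S)
    ... | tri< 0<DS _ _ = ℚP.≤-trans (ℚP.≤-reflexive (ℚP.*-comm c (D S))) (*-monoˡ-≤ (0≤D S) (c≤h S 0<DS))
    ... | tri≈ _ 0≡DS _ = ℚP.≤-reflexive (trans (cong (c *_) (sym 0≡DS))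
                            (trans (ℚP.*-zeroʳ c) (trans (sym (ℚP.*-zeroˡ (h S))) (cong (_* h S) 0≡DS))))
    ... | tri> _ _ DS<0 = ⊥-elim (ℚP.<-irrefl refl (ℚP.<-≤-trans DS<0 (0≤D S)))

  pairCount-pos : ∀ {D} → InDClass D → 0ℚ < ℕtoℚ (length (tuplePairs n k))
  pairCount-pos {D} ((_ , ΣD≡1) , Dfam , _ , D≡) = ≤∧≢⇒< (ℕtoℚ-nonNeg (length (tuplePairs n k))) λ L≡0 → ℚP.1≢0 (begin
    1ℚ                              ≡⟨ sym ΣD≡1 ⟩
    ΣL (allStates n k) D            ≡⟨ ΣL-cong (allStates n k) (λ S → trans (D≡ S) (cong (divQ _) L≡0)) ⟩
    ΣL (allStates n k) (λ _ → 0ℚ)   ≡⟨ ΣL-zero (allStates n k) ⟩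
    0ℚ                              ∎)
    where open ≡-Reasoning

  expect-InDClass : ∀ {D} (D∈𝒟 : InDClass D) (h : State n k → ℚ) →
    expect D h ≡ divQ 1ℚ (ℕtoℚ (length (tuplePairs n k)))
                 * ΣL (tuplePairs n k) (λ p → expect (proj₁ (proj₂ D∈𝒟) (proj₁ p) (proj₂ p)) h)
  expect-InDClass {D} D∈𝒟@(_ , Dfam , _ , D≡) h = begin
    ΣL Ω (λ S → D S * h S)
      ≡⟨ ΣL-cong Ω (λ S → cong (_* h S) (trans (D≡ S) (trans (divQ≡*divQ1 _ (pairCount-pos D∈𝒟))
                                                                 (cong (_* 1/L) (ΣL-cong pairs {h = λ p → Dp p S} (λ { (u , γ) → refl })))))) ⟩
    ΣL Ω (λ S → ΣL pairs (λ p → Dp p S) * 1/L * h S)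
      ≡⟨ ΣL-cong Ω (λ S → solve 3 (λ x i y → x :* i :* y := i :* (x :* y)) refl (ΣL pairs (λ p → Dp p S)) 1/L (h S)) ⟩
    ΣL Ω (λ S → 1/L * (ΣL pairs (λ p → Dp p S) * h S))
      ≡⟨ ΣL-* Ω 1/L (λ S → ΣL pairs (λ p → Dp p S) * h S) ⟩
    1/L * ΣL Ω (λ S → ΣL pairs (λ p → Dp p S) * h S)
      ≡⟨ cong (1/L *_) (ΣL-cong Ω (λ S → trans (ℚP.*-comm (ΣL pairs (λ p → Dp p S)) (h S))
                          (trans (sym (ΣL-* pairs (h S) (λ p → Dp p S))) (ΣL-cong pairs (λ p → ℚP.*-comm (h S) (Dp p S)))))) ⟩
    1/L * ΣL Ω (λ S → ΣL pairs (λ p → Dp p S * h S))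
      ≡⟨ cong (1/L *_) (ΣL-swap Ω pairs (λ S p → Dp p S * h S)) ⟩
    1/L * ΣL pairs (λ p → expect (Dp p) h) ∎
    where
    open ≡-Reasoning
    Ω = allStates n k
    pairs = tuplePairs n k
    1/L = divQ 1ℚ (ℕtoℚ (length pairs))
    Dp = λ (p : Vec (Fin n) k × Vec (Fin k) k) → Dfam (proj₁ p) (proj₂ p)

module _ {n′ k : ℕ} (α : Fin k) (ω : Fin (suc n′) → ℚ) (φ : State (suc n′) k → ℚ)
         (ω≤φ : ∀ S u → lookup S u ≡ α → ω u ≤ φ S) where

  private
    n = suc n′
    W = ΣL (allFin n) ω
    1/n = divQ 1ℚ (ℕtoℚ n)
    A = distinctTuples k n
    B = distinctTuples k k
    |A| = ℕtoℚ (length A)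
    |B| = ℕtoℚ (length B)

  ΣL-distinctTuples-ω : ∀ i → ΣL A (λ u → ω (lookup u i)) ≡ |A| * (W * 1/n)
  ΣL-distinctTuples-ω i = begin
    X                     ≡⟨ sym (ℚP.*-identityʳ X) ⟩
    X * 1ℚ                ≡⟨ cong (X *_) (sym (*-divQ1-inverse (ℕtoℚ-suc-pos n′))) ⟩
    X * (ℕtoℚ n * 1/n)    ≡⟨ sym (ℚP.*-assoc X (ℕtoℚ n) 1/n) ⟩
    X * ℕtoℚ n * 1/n      ≡⟨ cong (_* 1/n) (ΣL-distinctTuples-lookup i ω) ⟩
    |A| * W * 1/n         ≡⟨ ℚP.*-assoc |A| W 1/n ⟩
    |A| * (W * 1/n)       ∎
    where
    open ≡-Reasoning
    X = ΣL A (λ u → ω (lookup u i))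

  pairCount≡ : ℕtoℚ (length (tuplePairs n k)) ≡ |A| * |B|
  pairCount≡ = begin
    ℕtoℚ (length (tuplePairs n k))  ≡⟨ sym (ΣL-1 (tuplePairs n k)) ⟩
    ΣL (tuplePairs n k) (λ _ → 1ℚ)  ≡⟨ ΣL-cartesianProduct A B (λ _ → 1ℚ) ⟩
    ΣL A (λ _ → ΣL B (λ _ → 1ℚ))    ≡⟨ ΣL-cong A (λ _ → ΣL-1 B) ⟩
    ΣL A (λ _ → |B|)                ≡⟨ ΣL-const A |B| ⟩
    |B| * |A|                       ≡⟨ ℚP.*-comm |B| |A| ⟩
    |A| * |B|                       ∎
    where open ≡-Reasoning

  average-≥ : ∀ {D} → InDClass D → W * 1/n ≤ expect D φ
  average-≥ {D} D∈𝒟@(_ , Dfam , Dfam-dist , _) = begin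
    W * 1/n                                      ≡⟨ sym (ℚP.*-identityˡ (W * 1/n)) ⟩
    1ℚ * (W * 1/n)                               ≡⟨ cong (_* (W * 1/n)) (sym (trans (ℚP.*-comm 1/L L) (*-divQ1-inverse (pairCount-pos D∈𝒟)))) ⟩
    1/L * L * (W * 1/n)                          ≡⟨ cong (λ x → 1/L * x * (W * 1/n)) pairCount≡ ⟩
    1/L * (|A| * |B|) * (W * 1/n)
      ≡⟨ solve 4 (λ i a b w → i :* (a :* b) :* w := i :* ((a :* w) :* b)) refl 1/L |A| |B| (W * 1/n) ⟩
    1/L * (|A| * (W * 1/n) * |B|)                ≡⟨ cong (1/L *_) (sym (ΣL-const B (|A| * (W * 1/n)))) ⟩
    1/L * ΣL B (λ _ → |A| * (W * 1/n))           ≤⟨ *-monoˡ-≤ (ℚP.<⇒≤ (divQ1-pos (pairCount-pos D∈𝒟)))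
                                                     (ΣL-filterᵇ-mono distinct (allTuples k k) per-type-tuple) ⟩
    1/L * ΣL B (λ γ → ΣL A (λ u → E u γ))        ≡⟨ cong (1/L *_) (sym (ΣL-swap A B E)) ⟩
    1/L * ΣL A (λ u → ΣL B (λ γ → E u γ))        ≡⟨ cong (1/L *_) (sym (ΣL-cartesianProduct A B (λ p → E (proj₁ p) (proj₂ p)))) ⟩
    1/L * ΣL (tuplePairs n k) (λ p → E (proj₁ p) (proj₂ p)) ≡⟨ sym (expect-InDClass D∈𝒟 φ) ⟩
    expect D φ                                   ∎
    where
    open ℚP.≤-Reasoning
    L = ℕtoℚ (length (tuplePairs n k))
    1/L = divQ 1ℚ L
    E = λ u γ → expect (Dfam u γ) φ
    per-type-tuple : ∀ γ → distinct γ ≡ true → |A| * (W * 1/n) ≤ ΣL A (λ u → E u γ)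
    per-type-tuple γ dγ = subst (_≤ ΣL A (λ u → E u γ)) (ΣL-distinctTuples-ω i)
      (ΣL-filterᵇ-mono distinct (allTuples k n) λ u du →
        ≤-expect (proj₁ (Dfam-dist u γ du dγ)) λ S 0<D →
          ω≤φ S (lookup u i) (trans (proj₂ (Dfam-dist u γ du dγ) S 0<D i) γi≡α))
      where
      i = proj₁ (distinct-surjective γ dγ α)
      γi≡α = proj₂ (distinct-surjective γ dγ α)

-- Fixation of the fittest type

module Fixation {n′ k : ℕ} (G : Graph (suc n′)) (connected : Connected G)
                (f : Fin k → ℚ) (1≤f : ∀ i → 1ℚ ≤ f i) (α : Fin k) (f≤fα : ∀ j → f j ≤ f α) where

  open MoranStep G f 1≤f
  open Potential G f 1≤f α f≤fα
  open Absorption G connected f 1≤f α f≤fα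

  W : ℚ
  W = ΣL (allFin n) ω

  W-pos : 0ℚ < W
  W-pos = ℚP.<-≤-trans (weight-pos (deg G zero)) (term≤ΣL (allFin n) ω-nonNeg (∈-allFin zero))

  𝟙α-nonNeg : ∀ x → 0ℚ ≤ 𝟙α x
  𝟙α-nonNeg x with does (x F.≟ α)
  ... | true  = 0≤1
  ... | false = ℚP.≤-refl

  ω≤potential : ∀ S u → lookup S u ≡ α → ω u ≤ potential S
  ω≤potential S u Su≡α = ℚP.≤-trans (ℚP.≤-reflexive (sym 𝟙α-ω))
    (term≤ΣL (allFin n) (λ u → *-nonNeg (𝟙α-nonNeg (lookup S u)) (ω-nonNeg u)) (∈-allFin u))
    where
    𝟙α-ω : 𝟙α (lookup S u) * ω u ≡ ω u
    𝟙α-ω rewrite Su≡α | dec-true (α F.≟ α) refl = ℚP.*-identityˡ (ω u)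

  potential≤W : ∀ S → potential S ≤ W
  potential≤W S = ΣL-mono (allFin n) λ u → ℚP.≤-trans (*-monoʳ-≤ (ω-nonNeg u) (𝟙α≤1 (lookup S u))) (ℚP.≤-reflexive (ℚP.*-identityˡ (ω u)))
    where
    𝟙α≤1 : ∀ x → 𝟙α x ≤ 1ℚ
    𝟙α≤1 x with does (x F.≟ α)
    ... | true  = ℚP.≤-refl
    ... | false = 0≤1

  potential-monochromatic : ∀ S c → (∀ u → lookup S u ≡ c) → potential S ≡ 𝟙α c * W
  potential-monochromatic S c S≡c =
    trans (ΣL-cong (allFin n) (λ u → cong (λ x → 𝟙α x * ω u) (S≡c u))) (ΣL-* (allFin n) (𝟙α c) ω)

  -- Once fixated, the potential is W or 0 according to whether α won; before, it is at most W.
  potential≤fixated+unfixated : ∀ S → potential S ≤ W * (fixated α S + unfixated S)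
  potential≤fixated+unfixated S with allEq (lookup S zero) S in mono
  ... | false = begin
    potential S                   ≤⟨ potential≤W S ⟩
    W                             ≡⟨ sym (trans (cong (W *_) (ℚP.+-identityˡ 1ℚ)) (ℚP.*-identityʳ W)) ⟩
    W * (0ℚ + 1ℚ)                 ≤⟨ *-monoˡ-≤ (ℚP.<⇒≤ W-pos) (ℚP.+-monoˡ-≤ 1ℚ (fixated-nonNeg α S)) ⟩
    W * (fixated α S + 1ℚ)        ∎
    where open ℚP.≤-Reasoning
  ... | true  = by-winner (lookup S zero F.≟ α)
    where
    S≡S₀ = allEq⇒lookup (lookup S zero) S mono
    by-winner : Dec (lookup S zero ≡ α) → potential S ≤ W * (fixated α S + 0ℚ)
    by-winner (yes S₀≡α) = ℚP.≤-reflexive (begin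
      potential S                   ≡⟨ potential-monochromatic S α S≡α ⟩
      𝟙α α * W                      ≡⟨ cong (λ b → (if b then 1ℚ else 0ℚ) * W) (dec-true (α F.≟ α) refl) ⟩
      1ℚ * W                        ≡⟨ solve 1 (λ w → con 1ℚ :* w := w :* (con 1ℚ :+ con 0ℚ)) refl W ⟩
      W * (1ℚ + 0ℚ)                 ≡⟨ cong (λ b → W * ((if b then 1ℚ else 0ℚ) + 0ℚ)) (sym (lookup⇒allEq α S S≡α)) ⟩
      W * (fixated α S + 0ℚ)        ∎)
      where
      open ≡-Reasoning
      S≡α : ∀ u → lookup S u ≡ α
      S≡α u = trans (S≡S₀ u) S₀≡α
    by-winner (no S₀≢α) = begin
      potential S                   ≡⟨ potential-monochromatic S (lookup S zero) S≡S₀ ⟩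
      𝟙α (lookup S zero) * W        ≡⟨ cong (λ b → (if b then 1ℚ else 0ℚ) * W) (dec-false (lookup S zero F.≟ α) S₀≢α) ⟩
      0ℚ * W                        ≡⟨ ℚP.*-zeroˡ W ⟩
      0ℚ                            ≤⟨ *-nonNeg (ℚP.<⇒≤ W-pos) (subst (0ℚ ≤_) (sym (ℚP.+-identityʳ _)) (fixated-nonNeg α S)) ⟩
      W * (fixated α S + 0ℚ)        ∎
      where open ℚP.≤-Reasoning

  potential≤fixation : ∀ m S → potential S ≤ W * (evolve (m ℕ.* n) (fixated α) S + B ^ m)
  potential≤fixation m S = begin
    potential S                                          ≤⟨ potential≤evolve t S ⟩
    evolve t potential S                                 ≤⟨ evolve-mono potential≤fixated+unfixated t S ⟩
    evolve t (λ S → W * (fixated α S + unfixated S)) S   ≡⟨ evolve-* W (λ S → fixated α S + unfixated S) t S ⟩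
    W * evolve t (λ S → fixated α S + unfixated S) S     ≡⟨ cong (W *_) (evolve-+ (fixated α) unfixated t S) ⟩
    W * (evolve t (fixated α) S + evolve t unfixated S)  ≤⟨ *-monoˡ-≤ (ℚP.<⇒≤ W-pos)
                                                             (ℚP.+-monoʳ-≤ (evolve t (fixated α) S) (unfixated-decay m S)) ⟩
    W * (evolve t (fixated α) S + B ^ m)                 ∎
    where
    open ℚP.≤-Reasoning
    t = m ℕ.* n

  fixProbByD≥ : ∀ {D} → InDClass D → ∀ m → divQ 1ℚ (ℕtoℚ n) ≤ fixProbByD G f α (m ℕ.* n) D + B ^ m
  fixProbByD≥ {D} D∈𝒟 m = ℚP.*-cancelˡ-≤-pos W {{ℚ.positive W-pos}} (begin
    W * divQ 1ℚ (ℕtoℚ n)                                  ≤⟨ average-≥ α ω potential ω≤potential D∈𝒟 ⟩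
    expect D potential                                    ≤⟨ expect-mono (proj₁ (proj₁ D∈𝒟)) (potential≤fixation m) ⟩
    expect D (λ S → W * (evolve t (fixated α) S + B ^ m)) ≡⟨ expect-affine (proj₁ D∈𝒟) W (evolve t (fixated α)) (B ^ m) ⟩
    W * (expect D (evolve t (fixated α)) + B ^ m)         ≡⟨ cong (λ x → W * (x + B ^ m))
                                                              (ΣL-cong (allStates n k) (λ S → cong (D S *_) (sym (fixProbBy-evolve α t S)))) ⟩
    W * (fixProbByD G f α t D + B ^ m)                    ∎)
    where
    open ℚP.≤-Reasoning
    t = m ℕ.* n

  fixProbAtLeast-1/n : ∀ {D} → InDClass D → FixProbAtLeast G f α D (divQ 1ℚ (ℕtoℚ n))
  fixProbAtLeast-1/n {D} D∈𝒟 ε 0<ε =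
    m ℕ.* n , ℚP.≤-trans (fixProbByD≥ D∈𝒟 m) (ℚP.+-monoʳ-≤ (fixProbByD G f α (m ℕ.* n) D) B^m≤ε)
    where
    eventually : ∃ λ m → B ^ m ≤ ε
    eventually = ^-eventually-≤ (^-pos q-pos n) B-nonNeg 0<ε
    m = proj₁ eventually
    B^m≤ε = proj₂ eventually

corollary9 : (n k : ℕ) (G : Graph n) → Connected G →
    (f : Fin k → ℚ) → (∀ i → 1ℚ ≤ f i) →
    (α : Fin k) → (∀ j → f j ≤ f α) →
    (D : State n k → ℚ) → InDClass D →
    FixProbAtLeast G f α D (divQ 1ℚ (ℕtoℚ n))
corollary9 zero    zero    G connected f 1≤f () f≤fα D D∈𝒟
corollary9 zero    (suc k) G connected f 1≤f α  f≤fα D D∈𝒟 = ⊥-elim (ℚP.<-irrefl refl (pairCount-pos D∈𝒟))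
corollary9 (suc n) k       G connected f 1≤f α  f≤fα D D∈𝒟 = Fixation.fixProbAtLeast-1/n G connected f 1≤f α f≤fα D∈𝒟
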